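{- Let $a,N$ be positive integers and let $L\subseteq\{0,\dots,a-1\}$ be nonempty with $|L|=\ell$. Let $s_{L,N}$ and $S_{L,N}$ be the matrices with rows and columns indexed by $0\le n,k\le N$ and entries $$s_{L,N}(n,k)=\frac{(-1)^{n-k}}{\ell^n}\,\#\{\sigma\in C_a\wr S_n:\overleftarrow{\min}_L(\sigma)=k\},\qquad S_{L,N}(n,k)=\frac{1}{\ell^n}\,\#\{\sigma\in C_a\wr S_n: des_L(\sigma)=\overleftarrow{\min}_L(\sigma)=k\}.$$ Then $S_{L,N}^{ -1}=s_{L,N}$.
   Context: Let $\alpha=e^{2\pi i/a}$ and $C_a=\{\alpha^t:0\le t\le a-1\}$. The wreath product $C_a\wr S_n$ is identified with the group of bijections $\sigma$ of $\{\alpha^v j: 0\le v\le a-1,\ 1\le j\le n\}$ satisfying $\sigma(\beta j)=\beta\sigma(j)$ for $\beta\in C_a$; we write $\sigma=[\sigma(1),\dots,\sigma(n)]$, $\sigma(j)=\alpha^{t_j}|\sigma(j)|$ with $|\sigma(j)|\in\{1,\dots,n\}$, $|\sigma|=[|\sigma(1)|,\dots,|\sigma(n)|]\in S_n$, and $\sigma(0)=0$. For $n=0$ the group is trivial and all statistics are $0$. $\overleftarrow{\mathrm{Min}}_L(\sigma)$ is the set of values $|\sigma(i)|$ which are right-to-left minima of $|\sigma|$ (i.e. $|\sigma(i)|<|\sigma(j)|$ for all $j>i$) and such that $\sigma(i)=\alpha^u|\sigma(i)|$ with $u\in L$; $\overleftarrow{\min}_L(\sigma)$ is its cardinality. The $L$-order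 $<_L$ on $\{\alpha^vj\}\cup\{0\}$, with $U$ the complement of $L$ in $\{0,\dots,a-1\}$: $\alpha^v j<_L 0$ if $v\in L$, $\alpha^v j>_L0$ if $v\in U$; for $u,v\in L$, $i\neq j$: $\alpha^v i<_L\alpha^u j$ iff $i>j$; for $u,v\in U$, $i\ne j$: $\alpha^v i<_L\alpha^u j$ iff $i<j$; ties with equal $j$ broken arbitrarily. $des_L(\sigma)=\#\{0\le i\le n-1:\sigma(i)>_L\sigma(i+1)\}$ with $\sigma(0)=0$. -}

module Defs where

open import Data.Bool using (Bool; true; false; _∧_; if_then_else_; not)
open import Data.Nat using (ℕ; zero; suc; _+_; _^_; _<ᵇ_; _≡ᵇ_; NonZero)
open import Data.Nat.Properties using (m^n≢0)
open import Data.Fin using (Fin; toℕ)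
open import Data.Fin.Subset using (Subset; ∣_∣)
open import Data.List using (List; []; _∷_; map; concatMap; filterᵇ; length; foldr)
open import Data.Vec using (Vec; []; _∷_; lookup; toList; allFin)
open import Data.Product using (_×_; _,_; proj₁; proj₂)
open import Data.Integer as ℤ using (ℤ; +_; -_)
open import Data.Rational as ℚ using (ℚ; 0ℚ; 1ℚ)
open import Relation.Nullary.Decidable using (does)

-- Elements of the wreath product C_a ≀ S_n.
-- σ ∈ C_a ≀ S_n is determined by (σ(1),…,σ(n)), σ(j) = α^{t_j} |σ(j)|,
-- where t_j ∈ {0,…,a-1} is arbitrary and |σ| ∈ S_n.  We encode σ as the
-- word  ((t_1 , |σ(1)|-1) , … , (t_n , |σ(n)|-1))  : Vec (Fin a × Fin n) n
-- (values shifted by 1, which preserves all order comparisons), and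
-- C_a ≀ S_n is the list of all such words whose |·|-components are
-- pairwise distinct.

allVecs : {A : Set} → List A → (n : ℕ) → List (Vec A n)
allVecs xs zero    = [] ∷ []
allVecs xs (suc n) = concatMap (λ x → map (x ∷_) (allVecs xs n)) xs

allPairs : (a n : ℕ) → List (Fin a × Fin n)
allPairs a n = concatMap (λ c → map (c ,_) (toList (allFin n))) (toList (allFin a))

allᵇ : {A : Set} → (A → Bool) → List A → Bool
allᵇ p []       = true
allᵇ p (x ∷ xs) = p x ∧ allᵇ p xs

distinct : List ℕ → Bool
distinct []       = true
distinct (x ∷ xs) = allᵇ (λ y → not (x ≡ᵇ y)) xs ∧ distinct xs

Word : ℕ → ℕ → Set
Word a n = Vec (Fin a × Fin n) n

letters : ∀ {a n} → Word a n → List (Fin a × ℕ)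
letters w = map (λ p → proj₁ p , toℕ (proj₂ p)) (toList w)

wreath : (a n : ℕ) → List (Word a n)
wreath a n = filterᵇ (λ w → distinct (map proj₂ (letters w)))
                    (allVecs (allPairs a n) n)

inL : ∀ {a} → Subset a → Fin a → Bool
inL L u = lookup L u

-- min←_L : number of right-to-left minima of |σ| whose colour lies in L
rlminL-list : ∀ {a} → Subset a → List (Fin a × ℕ) → ℕ
rlminL-list L []             = 0
rlminL-list L ((u , v) ∷ xs) =
  (if inL L u ∧ allᵇ (λ y → v <ᵇ proj₂ y) xs then 1 else 0) + rlminL-list L xs

rlminL : ∀ {a n} → Subset a → Word a n → ℕ
rlminL L w = rlminL-list L (letters w)

-- points of {α^v j} ∪ {0}
data Pt (a : ℕ) : Set where
  origin : Pt a
  pt     : Fin a → ℕ → Pt a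

-- x <_L y  (the L-order).  Ties between letters with equal |·| never occur
-- between consecutive entries of σ, so their treatment is immaterial.
_<L_ : ∀ {a} {L : Subset a} → Pt a → Pt a → Bool
_<L_          origin   origin   = false
_<L_ {L = L} (pt u i) origin   = inL L u
_<L_ {L = L}  origin  (pt v j) = not (inL L v)
_<L_ {L = L} (pt u i) (pt v j) with inL L u | inL L v
... | true  | true  = j <ᵇ i
... | false | false = i <ᵇ j
... | true  | false = true
... | false | true  = false

descents : ∀ {a} → Subset a → List (Pt a) → ℕ
descents L []           = 0
descents L (x ∷ [])     = 0
descents L (x ∷ y ∷ xs) =
  (if _<L_ {L = L} y x then 1 else 0) + descents L (y ∷ xs)

-- des_L(σ), with σ(0) = 0
desL : ∀ {a n} → Subset a → Word a n → ℕ
desL L w = descents L (origin ∷ map (λ p → pt (proj₁ p) (proj₂ p)) (letters w))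

count : {A : Set} → (A → Bool) → List A → ℕ
count p xs = length (filterᵇ p xs)

cntMin : (a : ℕ) → Subset a → (n k : ℕ) → ℕ
cntMin a L n k = count (λ w → rlminL L w ≡ᵇ k) (wreath a n)

cntDesMin : (a : ℕ) → Subset a → (n k : ℕ) → ℕ
cntDesMin a L n k =
  count (λ w → (desL L w ≡ᵇ k) ∧ (rlminL L w ≡ᵇ k)) (wreath a n)

-- z / ℓ^n  (ℓ = |L| ≥ 1 in the theorem; the ℓ = 0 clause is never used)
divPow : ℤ → ℕ → ℕ → ℚ
divPow z zero    n = 0ℚ
divPow z (suc m) n = ℚ._/_ z (suc m ^ n) {{m^n≢0 (suc m) n}}

-- (-1)^{n-k}, written as (-1)^{n+k} (same value, also for k > n)
signℤ : ℕ → ℤ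
signℤ zero          = + 1
signℤ (suc zero)    = - (+ 1)
signℤ (suc (suc m)) = signℤ m

Matrix : ℕ → Set
Matrix N = Fin (suc N) → Fin (suc N) → ℚ

sMat : (a : ℕ) → Subset a → (N : ℕ) → Matrix N
sMat a L N n k =
  divPow (signℤ (toℕ n + toℕ k) ℤ.* + cntMin a L (toℕ n) (toℕ k)) ∣ L ∣ (toℕ n)

SMat : (a : ℕ) → Subset a → (N : ℕ) → Matrix N
SMat a L N n k = divPow (+ cntDesMin a L (toℕ n) (toℕ k)) ∣ L ∣ (toℕ n)

sumFin : ∀ {m} → (Fin m → ℚ) → ℚ
sumFin {m} f = foldr ℚ._+_ 0ℚ (map f (toList (allFin m)))

_⊗_ : ∀ {N} → Matrix N → Matrix N → Matrix N
(A ⊗ B) i j = sumFin (λ k → A i k ℚ.* B k j)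

identity : ∀ {N} → Matrix N
identity i j = if does (Data.Fin._≟_ i j) then 1ℚ else 0ℚ

-- A coloured permutation is encoded by its letters (colour, |σ(j)| - 1), and every element of
-- C_a ≀ S_(n+1) arises exactly once from one of C_a ≀ S_n by inserting the new maximum with some
-- colour at some position. Appending it adds 1 to both min←_L and des_L when its colour lies in L
-- and 0 otherwise; inserting it in front of a letter keeps min←_L, keeps des_L in a descent slot
-- and raises it by one in every other slot. With ℓ = |L| and u = a - ℓ this gives the recurrences
--   #{min←_L = k}(n+1)        = ℓ #{min←_L = k-1}(n)        + (u + a n) #{min←_L = k}(n),
--   #{des_L = min←_L = k}(n+1) = ℓ #{des_L = min←_L = k-1}(n) + (u + a k) #{des_L = min←_L = k}(n),
-- the second because min←_L ≤ des_L. After division by ℓⁿ, s_{L,N} and S_{L,N} are the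
-- generalised Stirling numbers of the first and second kind of the sequence b j = (u + a j) / ℓ,
-- and these two lower triangular arrays are inverse to each other for every sequence b.

module Submission where

open import Defs
open import Data.Nat using (ℕ; suc; _≤_)
open import Data.Fin using (Fin)
open import Data.Fin.Subset using (Subset; Nonempty)
open import Data.Product using (_×_)
open import Relation.Binary.PropositionalEquality using (_≡_)

open import Data.Bool using (Bool; true; false; _∧_; if_then_else_; not; T)
open import Data.Bool.Properties using (∧-identityʳ; ∧-zeroʳ; T-∧; T-≡)
open import Data.Empty using (⊥-elim)
open import Data.Fin using (toℕ; fromℕ<)
import Data.Fin as Fin
open import Data.Fin.Properties using (toℕ-injective; toℕ-fromℕ<; toℕ<n)
open import Data.Fin.Subset using (∣_∣; ∁)
import Data.Integer.Properties as ℤ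
open import Data.Integer.Solver renaming (module +-*-Solver to ℤSolver)
open import Data.List using (List; []; _∷_; map; concatMap; length; _++_; foldr)
import Data.List as List
open import Data.List.Membership.Propositional using (_∈_; _∉_; find)
open import Data.List.Membership.Propositional.Properties
open import Data.List.Membership.DecPropositional Data.Nat._≟_ using (_∈?_)
open import Data.List.Properties using (map-++; map-∘; map-cong; length-map; map-tabulate; ∷-injective; ∷-injectiveˡ; ∷-injectiveʳ)
open import Data.List.Relation.Binary.Permutation.Propositional using (_↭_; prep; swap; ↭-refl; ↭-trans; ↭-sym; ↭⇒↭ₛ)
import Data.List.Relation.Binary.Permutation.Propositional.Properties as ↭
open ↭ using (All-resp-↭)
import Data.List.Relation.Binary.Permutation.Setoid.Properties as PermutationSetoid
open import Data.List.Relation.Unary.All as All using (All; []; _∷_)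
open import Data.List.Relation.Unary.All.Properties using () renaming (map⁺ to All-map⁺; map⁻ to All-map⁻)
import Data.List.Relation.Unary.AllPairs as AllPairs
open import Data.List.Relation.Unary.Any as Any using (here; there)
open import Data.List.Relation.Unary.Unique.Propositional using (Unique; []; _∷_)
import Data.List.Relation.Unary.Unique.Propositional.Properties as Unique
open import Data.Maybe using (Maybe; just; nothing)
open import Data.Maybe.Properties using (just-injective)
open import Data.Nat using (zero; _<_; z≤n; s≤s; _≡ᵇ_; _<ᵇ_)
import Data.Nat as ℕ
open import Data.Nat.Base using (s≤s⁻¹)
open import Data.Nat.ListAction using (sum)
open import Data.Nat.ListAction.Properties using (sum-++; sum-↭)
open import Data.Nat.Properties
open import Data.Nat.Solver renaming (module +-*-Solver to ℕSolver)
open import Data.Product using (∃; _,_; proj₁; proj₂)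
open import Data.Rational as ℚ using (ℚ; 0ℚ; 1ℚ; fromℚᵘ; _/_)
import Data.Rational.Properties as ℚ
open import Data.Rational.Solver renaming (module +-*-Solver to ℚSolver)
open import Data.Rational.Unnormalised as ℚᵘ using (ℚᵘ; mkℚᵘ; *≡*)
import Data.Rational.Unnormalised.Properties as ℚᵘ
open import Data.Sum using (inj₁; inj₂)
open import Data.Unit using (⊤; tt)
open import Data.Vec using (Vec; toList; tabulate; allFin; lookup) renaming ([] to []ᵥ; _∷_ to _∷ᵥ_)
import Data.Vec as Vec
open import Data.Vec.Base using (there)
import Data.Vec.Properties as Vec
open import Function using (_∘_)
open import Function.Bundles using (Equivalence)
open import Relation.Binary.PropositionalEquality using (_≢_; setoid; refl; sym; trans; cong; cong₂; subst; module ≡-Reasoning)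
open import Relation.Nullary using (¬_; yes; no)
open import Relation.Nullary.Decidable using (T?)

-- Generalised Stirling numbers

module FiniteSums where

  open import Data.Rational using (_+_; _*_)
  open ℚSolver

  δ : ℕ → ℕ → ℚ
  δ n j = if n ≡ᵇ j then 1ℚ else 0ℚ

  Σ< : ℕ → (ℕ → ℚ) → ℚ
  Σ< zero    f = 0ℚ
  Σ< (suc M) f = f 0 + Σ< M (f ∘ suc)

  Σ<-cong : ∀ M {f g : ℕ → ℚ} → (∀ k → f k ≡ g k) → Σ< M f ≡ Σ< M g
  Σ<-cong zero    f≗g = refl
  Σ<-cong (suc M) f≗g = cong₂ _+_ (f≗g 0) (Σ<-cong M (f≗g ∘ suc))

  Σ<-+ : ∀ M (f g : ℕ → ℚ) → Σ< M (λ k → f k + g k) ≡ Σ< M f + Σ< M g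
  Σ<-+ zero    f g = refl
  Σ<-+ (suc M) f g rewrite Σ<-+ M (f ∘ suc) (g ∘ suc) =
    solve 4 (λ a b c d → (a :+ b) :+ (c :+ d) := (a :+ c) :+ (b :+ d)) refl
      (f 0) (g 0) (Σ< M (f ∘ suc)) (Σ< M (g ∘ suc))

  Σ<-* : ∀ M c (f : ℕ → ℚ) → Σ< M (λ k → c * f k) ≡ c * Σ< M f
  Σ<-* zero    c f = solve 1 (λ c → con 0ℚ := c :* con 0ℚ) refl c
  Σ<-* (suc M) c f rewrite Σ<-* M c (f ∘ suc) =
    solve 3 (λ c a b → c :* a :+ c :* b := c :* (a :+ b)) refl c (f 0) (Σ< M (f ∘ suc))

  Σ<-0 : ∀ M → Σ< M (λ _ → 0ℚ) ≡ 0ℚ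
  Σ<-0 zero    = refl
  Σ<-0 (suc M) rewrite Σ<-0 M = refl

  Σ<-last : ∀ M (f : ℕ → ℚ) → Σ< (suc M) f ≡ Σ< M f + f M
  Σ<-last zero    f = solve 1 (λ a → a :+ con 0ℚ := con 0ℚ :+ a) refl (f 0)
  Σ<-last (suc M) f rewrite Σ<-last M (f ∘ suc) =
    solve 3 (λ a b c → a :+ (b :+ c) := (a :+ b) :+ c) refl (f 0) (Σ< M (f ∘ suc)) (f (suc M))

  Σ<-δ₀ : ∀ M (t : ℕ → ℚ) → Σ< (suc M) (λ k → δ 0 k * t k) ≡ t 0
  Σ<-δ₀ M t = begin
    1ℚ * t 0 + Σ< M (λ k → 0ℚ * t (suc k))
      ≡⟨ cong (1ℚ * t 0 +_) (trans (Σ<-cong M λ k → solve 1 (λ x → con 0ℚ :* x := con 0ℚ) refl (t (suc k)))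
                                   (Σ<-0 M)) ⟩
    1ℚ * t 0 + 0ℚ
      ≡⟨ solve 1 (λ x → con 1ℚ :* x :+ con 0ℚ := x) refl (t 0) ⟩
    t 0 ∎
    where open ≡-Reasoning

  δ-suc-diag : ∀ j → δ (suc j) j ≡ 0ℚ
  δ-suc-diag zero    = refl
  δ-suc-diag (suc j) = δ-suc-diag j

-- For b j = j these are the signed Stirling numbers of the first and second kind:
-- stirling₁ n k is the coefficient of xᵏ in (x - b 0) ⋯ (x - b (n - 1)).
module GeneralisedStirling (b : ℕ → ℚ) where

  open import Data.Rational using (_+_; _*_; -_; _-_)
  open ℚSolver
  open FiniteSums

  stirling₁ : ℕ → ℕ → ℚ
  stirling₁ zero    zero    = 1ℚ
  stirling₁ zero    (suc k) = 0ℚ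
  stirling₁ (suc n) zero    = - (b n * stirling₁ n 0)
  stirling₁ (suc n) (suc k) = stirling₁ n k - b n * stirling₁ n (suc k)

  stirling₂ : ℕ → ℕ → ℚ
  stirling₂ zero    zero    = 1ℚ
  stirling₂ zero    (suc k) = 0ℚ
  stirling₂ (suc n) zero    = b 0 * stirling₂ n 0
  stirling₂ (suc n) (suc k) = stirling₂ n k + b (suc k) * stirling₂ n (suc k)

  stirling₁-above : ∀ n k → n < k → stirling₁ n k ≡ 0ℚ
  stirling₁-above zero    (suc k) _       = refl
  stirling₁-above (suc n) (suc k) (s≤s n<k)
    rewrite stirling₁-above n k n<k | stirling₁-above n (suc k) (m≤n⇒m≤1+n n<k) =
      solve 1 (λ b → con 0ℚ :- b :* con 0ℚ := con 0ℚ) refl (b n)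

  stirling₂-above : ∀ n k → n < k → stirling₂ n k ≡ 0ℚ
  stirling₂-above zero    (suc k) _       = refl
  stirling₂-above (suc n) (suc k) (s≤s n<k)
    rewrite stirling₂-above n k n<k | stirling₂-above n (suc k) (m≤n⇒m≤1+n n<k) =
      solve 1 (λ b → con 0ℚ :+ b :* con 0ℚ := con 0ℚ) refl (b (suc k))

  -- Expand row n + 1 by the recurrence and shift the summation index; the boundary term
  -- k = M vanishes by triangularity.
  stirling₂-row-suc : ∀ n j M → n < M →
    Σ< (suc M) (λ k → stirling₂ (suc n) k * stirling₁ k j)
      ≡ Σ< M (λ k → stirling₂ n k * (stirling₁ (suc k) j + b k * stirling₁ k j))
  stirling₂-row-suc n j M n<M = begin
    H 0 + Σ< M (λ k → stirling₂ (suc n) (suc k) * stirling₁ (suc k) j)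
      ≡⟨ cong (H 0 +_) (Σ<-cong M λ k →
           solve 4 (λ A B C D → (A :+ B :* C) :* D := A :* D :+ B :* C :* D) refl
             (stirling₂ n k) (b (suc k)) (stirling₂ n (suc k)) (stirling₁ (suc k) j)) ⟩
    H 0 + Σ< M (λ k → F k + H (suc k))
      ≡⟨ cong (H 0 +_) (Σ<-+ M F (H ∘ suc)) ⟩
    H 0 + (Σ< M F + Σ< M (H ∘ suc))
      ≡⟨ solve 3 (λ a b c → a :+ (b :+ c) := b :+ (a :+ c)) refl (H 0) (Σ< M F) (Σ< M (H ∘ suc)) ⟩
    Σ< M F + Σ< (suc M) H
      ≡⟨ cong (Σ< M F +_) (Σ<-last M H) ⟩
    Σ< M F + (Σ< M H + b M * stirling₂ n M * stirling₁ M j)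
      ≡⟨ cong (λ z → Σ< M F + (Σ< M H + b M * z * stirling₁ M j)) (stirling₂-above n M n<M) ⟩
    Σ< M F + (Σ< M H + b M * 0ℚ * stirling₁ M j)
      ≡⟨ cong (Σ< M F +_)
              (solve 3 (λ a b c → a :+ b :* con 0ℚ :* c := a) refl (Σ< M H) (b M) (stirling₁ M j)) ⟩
    Σ< M F + Σ< M H
      ≡⟨ Σ<-+ M F H ⟨
    Σ< M (λ k → F k + H k)
      ≡⟨ Σ<-cong M (λ k → solve 4 (λ A B C D → A :* B :+ C :* A :* D := A :* (B :+ C :* D)) refl
                            (stirling₂ n k) (stirling₁ (suc k) j) (b k) (stirling₁ k j)) ⟩
    Σ< M (λ k → stirling₂ n k * (stirling₁ (suc k) j + b k * stirling₁ k j)) ∎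
    where
      open ≡-Reasoning
      F H : ℕ → ℚ
      F k = stirling₂ n k * stirling₁ (suc k) j
      H k = b k * stirling₂ n k * stirling₁ k j

  stirling₁-row-suc : ∀ n j M → n < M →
    Σ< (suc M) (λ k → stirling₁ (suc n) k * stirling₂ k j)
      ≡ Σ< M (λ k → stirling₁ n k * (stirling₂ (suc k) j - b n * stirling₂ k j))
  stirling₁-row-suc n j M n<M = begin
    stirling₁ (suc n) 0 * stirling₂ 0 j + Σ< M (λ k → stirling₁ (suc n) (suc k) * stirling₂ (suc k) j)
      ≡⟨ cong₂ _+_
           (solve 3 (λ a b c → (:- (a :* b)) :* c := (:- a) :* (b :* c)) refl (b n) (stirling₁ n 0) (stirling₂ 0 j))
           (Σ<-cong M λ k → solve 4 (λ A B C D → (A :- B :* C) :* D := A :* D :+ (:- B) :* (C :* D)) refl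
                              (stirling₁ n k) (b n) (stirling₁ n (suc k)) (stirling₂ (suc k) j)) ⟩
    c * H 0 + Σ< M (λ k → F k + c * H (suc k))
      ≡⟨ cong (c * H 0 +_) (trans (Σ<-+ M F (λ k → c * H (suc k))) (cong (Σ< M F +_) (Σ<-* M c (H ∘ suc)))) ⟩
    c * H 0 + (Σ< M F + c * Σ< M (H ∘ suc))
      ≡⟨ solve 4 (λ c a b d → c :* a :+ (b :+ c :* d) := b :+ c :* (a :+ d)) refl
           c (H 0) (Σ< M F) (Σ< M (H ∘ suc)) ⟩
    Σ< M F + c * Σ< (suc M) H
      ≡⟨ cong (λ z → Σ< M F + c * z) (Σ<-last M H) ⟩
    Σ< M F + c * (Σ< M H + stirling₁ n M * stirling₂ M j)
      ≡⟨ cong (λ z → Σ< M F + c * (Σ< M H + z * stirling₂ M j)) (stirling₁-above n M n<M) ⟩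
    Σ< M F + c * (Σ< M H + 0ℚ * stirling₂ M j)
      ≡⟨ cong (Σ< M F +_)
              (solve 3 (λ c a d → c :* (a :+ con 0ℚ :* d) := c :* a) refl c (Σ< M H) (stirling₂ M j)) ⟩
    Σ< M F + c * Σ< M H
      ≡⟨ cong (Σ< M F +_) (Σ<-* M c H) ⟨
    Σ< M F + Σ< M (λ k → c * H k)
      ≡⟨ Σ<-+ M F _ ⟨
    Σ< M (λ k → F k + c * H k)
      ≡⟨ Σ<-cong M (λ k → solve 4 (λ A B C D → A :* B :+ (:- C) :* (A :* D) := A :* (B :- C :* D)) refl
                            (stirling₁ n k) (stirling₂ (suc k) j) (b n) (stirling₂ k j)) ⟩
    Σ< M (λ k → stirling₁ n k * (stirling₂ (suc k) j - b n * stirling₂ k j)) ∎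
    where
      open ≡-Reasoning
      c : ℚ
      c = - b n
      F H : ℕ → ℚ
      F k = stirling₁ n k * stirling₂ (suc k) j
      H k = stirling₁ n k * stirling₂ k j

  stirling₁-zero : ∀ j → stirling₁ 0 j ≡ δ 0 j
  stirling₁-zero zero    = refl
  stirling₁-zero (suc j) = refl

  stirling₂-zero : ∀ j → stirling₂ 0 j ≡ δ 0 j
  stirling₂-zero zero    = refl
  stirling₂-zero (suc j) = refl

  stirling₂-stirling₁-inverse : ∀ n j M → n < M → Σ< M (λ k → stirling₂ n k * stirling₁ k j) ≡ δ n j
  stirling₂-stirling₁-inverse zero    j       (suc M) _ =
    trans (Σ<-δ₀ M (λ k → stirling₁ k j)) (stirling₁-zero j)
  stirling₂-stirling₁-inverse (suc n) zero    (suc M) (s≤s n<M) = begin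
    _ ≡⟨ stirling₂-row-suc n 0 M n<M ⟩
    _ ≡⟨ Σ<-cong M (λ k → solve 3 (λ A B C → A :* ((:- (B :* C)) :+ B :* C) := con 0ℚ) refl
                            (stirling₂ n k) (b k) (stirling₁ k 0)) ⟩
    _ ≡⟨ Σ<-0 M ⟩
    0ℚ ∎
    where open ≡-Reasoning
  stirling₂-stirling₁-inverse (suc n) (suc j) (suc M) (s≤s n<M) = begin
    _ ≡⟨ stirling₂-row-suc n (suc j) M n<M ⟩
    _ ≡⟨ Σ<-cong M (λ k → solve 4 (λ A B C D → A :* ((B :- C :* D) :+ C :* D) := A :* B) refl
                            (stirling₂ n k) (stirling₁ k j) (b k) (stirling₁ k (suc j))) ⟩
    _ ≡⟨ stirling₂-stirling₁-inverse n j M n<M ⟩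
    δ n j ∎
    where open ≡-Reasoning

  stirling₁-stirling₂-inverse : ∀ n j M → n < M → Σ< M (λ k → stirling₁ n k * stirling₂ k j) ≡ δ n j
  stirling₁-stirling₂-inverse zero    j       (suc M) _ =
    trans (Σ<-δ₀ M (λ k → stirling₂ k j)) (stirling₂-zero j)
  stirling₁-stirling₂-inverse (suc n) zero    (suc M) (s≤s n<M) = begin
    _ ≡⟨ stirling₁-row-suc n 0 M n<M ⟩
    _ ≡⟨ Σ<-cong M (λ k → solve 4 (λ A B C D → A :* (B :* D :- C :* D) := (B :- C) :* (A :* D)) refl
                            (stirling₁ n k) (b 0) (b n) (stirling₂ k 0)) ⟩
    _ ≡⟨ Σ<-* M (b 0 - b n) _ ⟩
    _ ≡⟨ cong ((b 0 - b n) *_) (stirling₁-stirling₂-inverse n 0 M n<M) ⟩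
    (b 0 - b n) * δ n 0 ≡⟨ vanish n ⟩
    0ℚ ∎
    where
      open ≡-Reasoning
      vanish : ∀ n → (b 0 - b n) * δ n 0 ≡ 0ℚ
      vanish zero    = solve 1 (λ x → (x :- x) :* con 1ℚ := con 0ℚ) refl (b 0)
      vanish (suc n) = solve 2 (λ x y → (x :- y) :* con 0ℚ := con 0ℚ) refl (b 0) (b (suc n))
  stirling₁-stirling₂-inverse (suc n) (suc j) (suc M) (s≤s n<M) = begin
    _ ≡⟨ stirling₁-row-suc n (suc j) M n<M ⟩
    _ ≡⟨ Σ<-cong M (λ k → solve 5 (λ A B C D E → A :* ((B :+ C :* E) :- D :* E) := A :* B :+ (C :- D) :* (A :* E))
                            refl (stirling₁ n k) (stirling₂ k j) (b (suc j)) (b n) (stirling₂ k (suc j))) ⟩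
    _ ≡⟨ Σ<-+ M _ _ ⟩
    _ ≡⟨ cong₂ _+_ (stirling₁-stirling₂-inverse n j M n<M)
                   (trans (Σ<-* M (b (suc j) - b n) _)
                          (cong ((b (suc j) - b n) *_) (stirling₁-stirling₂-inverse n (suc j) M n<M))) ⟩
    δ n j + (b (suc j) - b n) * δ n (suc j) ≡⟨ vanish n ⟩
    δ n j ∎
    where
      open ≡-Reasoning
      vanish : ∀ m → δ m j + (b (suc j) - b m) * δ m (suc j) ≡ δ m j
      vanish m with m ≡ᵇ suc j in eq
      ... | false = solve 2 (λ x y → x :+ y :* con 0ℚ := x) refl (δ m j) (b (suc j) - b m)
      ... | true with refl ← ≡ᵇ⇒≡ m (suc j) (subst T (sym eq) _) rewrite δ-suc-diag j =
        solve 1 (λ x → con 0ℚ :+ (x :- x) :* con 1ℚ := con 0ℚ) refl (b (suc j))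

-- Counting lemmas for lists

open import Data.Nat using (_+_; _*_)

ι : Bool → ℕ
ι b = if b then 1 else 0

private variable
  A B : Set

count≡sum : (q : A → Bool) (xs : List A) → count q xs ≡ sum (map (ι ∘ q) xs)
count≡sum q [] = refl
count≡sum q (x ∷ xs) with q x
... | true  = cong suc (count≡sum q xs)
... | false = count≡sum q xs

count-none : (xs : List A) → count (λ _ → false) xs ≡ 0
count-none []       = refl
count-none (x ∷ xs) = count-none xs

count-↭ : (q : A → Bool) {xs ys : List A} → xs ↭ ys → count q xs ≡ count q ys
count-↭ q {xs} {ys} p = begin
  count q xs              ≡⟨ count≡sum q xs ⟩
  sum (map (ι ∘ q) xs)    ≡⟨ sum-↭ (↭.map⁺ (ι ∘ q) p) ⟩
  sum (map (ι ∘ q) ys)    ≡⟨ count≡sum q ys ⟨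
  count q ys              ∎
  where open ≡-Reasoning

count-map : (q : A → Bool) (f : B → A) (xs : List B) →
            count q (map f xs) ≡ count (q ∘ f) xs
count-map q f []       = refl
count-map q f (x ∷ xs) with q (f x)
... | true  = cong suc (count-map q f xs)
... | false = count-map q f xs

sum-cong-∈ : (f g : A → ℕ) (xs : List A) → (∀ x → x ∈ xs → f x ≡ g x) →
             sum (map f xs) ≡ sum (map g xs)
sum-cong-∈ f g []       h = refl
sum-cong-∈ f g (x ∷ xs) h = cong₂ _+_ (h x (here refl)) (sum-cong-∈ f g xs (λ y → h y ∘ there))

sum-map-const : (K : ℕ) (xs : List A) → sum (map (λ _ → K) xs) ≡ length xs * K
sum-map-const K []       = refl
sum-map-const K (x ∷ xs) = cong (K +_) (sum-map-const K xs)

sum-map-linear : (P Q : ℕ) (f g : A → ℕ) (xs : List A) →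
  sum (map (λ x → P * f x + Q * g x) xs) ≡ P * sum (map f xs) + Q * sum (map g xs)
sum-map-linear P Q f g [] = solve 2 (λ P Q → con 0 := P :* con 0 :+ Q :* con 0) refl P Q
  where open ℕSolver
sum-map-linear P Q f g (x ∷ xs) rewrite sum-map-linear P Q f g xs =
  solve 6 (λ P Q a b c d → P :* a :+ Q :* b :+ (P :* c :+ Q :* d) := P :* (a :+ c) :+ Q :* (b :+ d))
    refl P Q (f x) (g x) (sum (map f xs)) (sum (map g xs))
  where open ℕSolver

sum-concatMap : (f : B → List A) (g : A → ℕ) (xs : List B) →
  sum (map g (concatMap f xs)) ≡ sum (map (λ x → sum (map g (f x))) xs)
sum-concatMap f g []       = refl
sum-concatMap f g (x ∷ xs) = begin
  sum (map g (f x ++ concatMap f xs))             ≡⟨ cong sum (map-++ g (f x) (concatMap f xs)) ⟩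
  sum (map g (f x) ++ map g (concatMap f xs))     ≡⟨ sum-++ (map g (f x)) _ ⟩
  sum (map g (f x)) + sum (map g (concatMap f xs)) ≡⟨ cong (sum (map g (f x)) +_) (sum-concatMap f g xs) ⟩
  _                                               ∎
  where open ≡-Reasoning

count-concatMap : (q : A → Bool) (f : B → List A) (xs : List B) →
  count q (concatMap f xs) ≡ sum (map (λ x → count q (f x)) xs)
count-concatMap q f xs = begin
  count q (concatMap f xs)                        ≡⟨ count≡sum q (concatMap f xs) ⟩
  sum (map (ι ∘ q) (concatMap f xs))              ≡⟨ sum-concatMap f (ι ∘ q) xs ⟩
  sum (map (λ x → sum (map (ι ∘ q) (f x))) xs)    ≡⟨ sum-cong-∈ _ _ xs (λ x _ → sym (count≡sum q (f x))) ⟩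
  sum (map (λ x → count q (f x)) xs)              ∎
  where open ≡-Reasoning

toList-tabulate : ∀ {m} (g : Fin m → A) → toList (tabulate g) ≡ List.tabulate g
toList-tabulate {m = zero}  g = refl
toList-tabulate {m = suc m} g = cong (g Fin.zero ∷_) (toList-tabulate (g ∘ Fin.suc))

Unique-resp-↭ : {xs ys : List A} → xs ↭ ys → Unique xs → Unique ys
Unique-resp-↭ {A} p = PermutationSetoid.Unique-resp-↭ (setoid A) (↭⇒↭ₛ p)

∈-∷-≢ : {x y : A} {xs : List A} → x ∈ y ∷ xs → x ≢ y → x ∈ xs
∈-∷-≢ (here x≡y) x≢y = ⊥-elim (x≢y x≡y)
∈-∷-≢ (there x∈)  _  = x∈

Unique-drop-middle : (ys : List A) {v : A} {zs : List A} → Unique (ys ++ v ∷ zs) → Unique (v ∷ ys ++ zs)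
Unique-drop-middle ys {v} {zs} = Unique-resp-↭ (↭.shift v ys zs)

sameMembers-Unique⇒↭ : (xs ys : List A) → Unique xs → Unique ys →
  (∀ z → z ∈ xs → z ∈ ys) → (∀ z → z ∈ ys → z ∈ xs) → xs ↭ ys
sameMembers-Unique⇒↭ []       []       _  _  _  _ = ↭-refl
sameMembers-Unique⇒↭ []       (y ∷ ys) _  _  _  g with () ← g y (here refl)
sameMembers-Unique⇒↭ (x ∷ xs) ys (x∉xs ∷ uxs) uys f g with ∈-∃++ (f x (here refl))
... | ys₁ , ys₂ , refl = ↭-trans (prep x xs↭ys′) (↭-sym ys↭)
  where
    ys↭ : ys₁ ++ x ∷ ys₂ ↭ x ∷ ys₁ ++ ys₂
    ys↭ = ↭.shift x ys₁ ys₂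
    uys′ : Unique (x ∷ ys₁ ++ ys₂)
    uys′ = Unique-resp-↭ ys↭ uys
    xs↭ys′ : xs ↭ ys₁ ++ ys₂
    xs↭ys′ = sameMembers-Unique⇒↭ xs (ys₁ ++ ys₂) uxs (AllPairs.tail uys′)
      (λ z z∈ → ∈-∷-≢ (↭.∈-resp-↭ ys↭ (f z (there z∈)))
                      (λ { refl → Unique.Unique[x∷xs]⇒x∉xs (x∉xs ∷ uxs) z∈ }))
      (λ z z∈ → ∈-∷-≢ (g z (↭.∈-resp-↭ (↭-sym ys↭) (there z∈)))
                      (λ { refl → Unique.Unique[x∷xs]⇒x∉xs uys′ z∈ }))

concatMap-Unique : {C : Set} (f : A → List B) (xs : List A) (r : B → C) (g : A → C) →
  (∀ {x y} → g x ≡ g y → x ≡ y) → Unique xs → (∀ x → x ∈ xs → Unique (f x)) →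
  (∀ x → x ∈ xs → ∀ v → v ∈ f x → r v ≡ g x) → Unique (concatMap f xs)
concatMap-Unique f []       r g g-inj _           _  _   = []
concatMap-Unique f (x ∷ xs) r g g-inj (x∉xs ∷ uxs) uf tag =
  Unique.++⁺ (uf x (here refl))
    (concatMap-Unique f xs r g g-inj uxs (λ y → uf y ∘ there) (λ y → tag y ∘ there))
    disjoint
  where
    disjoint : ∀ {v} → ¬ (v ∈ f x × v ∈ concatMap f xs)
    disjoint {v} (v∈fx , v∈rest) with find (∈-concatMap⁻ f {xs = xs} v∈rest)
    ... | y , y∈xs , v∈fy =
      All.lookup x∉xs y∈xs (g-inj (trans (sym (tag x (here refl) v v∈fx)) (tag y (there y∈xs) v v∈fy)))

below-∉ : ∀ {m} {xs : List ℕ} → All (_< suc m) xs → m ∉ xs → All (_< m) xs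
below-∉ {m} bound m∉ = All.tabulate λ {z} z∈ →
  ≤∧≢⇒< (s≤s⁻¹ (All.lookup bound z∈)) (λ { refl → m∉ z∈ })

Unique-bounded⇒length≤ : ∀ m {xs : List ℕ} → Unique xs → All (_< m) xs → length xs ≤ m
Unique-bounded⇒length≤ zero    {[]}    _   _          = z≤n
Unique-bounded⇒length≤ zero    {_ ∷ _} _   (() ∷ _)
Unique-bounded⇒length≤ (suc m) {xs}    uxs bound with m ∈? xs
... | no  m∉xs = m≤n⇒m≤1+n (Unique-bounded⇒length≤ m uxs (below-∉ bound m∉xs))
... | yes m∈xs with ∈-∃++ m∈xs
...   | ys , zs , refl = begin
  length (ys ++ m ∷ zs)  ≡⟨ ↭.↭-length (↭.shift m ys zs) ⟩
  suc (length (ys ++ zs)) ≤⟨ s≤s (Unique-bounded⇒length≤ m (AllPairs.tail u′) rest-bound) ⟩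
  suc m                   ∎
  where
    open ≤-Reasoning
    u′ : Unique (m ∷ ys ++ zs)
    u′ = Unique-drop-middle ys uxs
    rest-bound : All (_< m) (ys ++ zs)
    rest-bound = below-∉ (All.tail (↭.All-resp-↭ (↭.shift m ys zs) bound)) (Unique.Unique[x∷xs]⇒x∉xs u′)

Unique-full⇒max∈ : ∀ n {xs : List ℕ} → Unique xs → All (_< suc n) xs → length xs ≡ suc n → n ∈ xs
Unique-full⇒max∈ n {xs} uxs bound len with n ∈? xs
... | yes n∈xs = n∈xs
... | no  n∉xs = ⊥-elim (<-irrefl refl (subst (_≤ n) len (Unique-bounded⇒length≤ n uxs (below-∉ bound n∉xs))))

<ᵇ-true : ∀ {i j} → i < j → (i <ᵇ j) ≡ true
<ᵇ-true {i} {j} i<j with i <ᵇ j | <⇒<ᵇ i<j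
... | true | _ = refl

<ᵇ-false : ∀ {i j} → j < i → (i <ᵇ j) ≡ false
<ᵇ-false {i} {j} j<i with i <ᵇ j in eq
... | false = refl
... | true  = ⊥-elim (<-asym j<i (<ᵇ⇒< i j (subst T (sym eq) _)))

≡ᵇ-true⇒≡ : ∀ {m n} → (m ≡ᵇ n) ≡ true → m ≡ n
≡ᵇ-true⇒≡ {m} {n} e = ≡ᵇ⇒≡ m n (subst T (sym e) _)

≢⇒≡ᵇ-false : ∀ {m n} → m ≢ n → (m ≡ᵇ n) ≡ false
≢⇒≡ᵇ-false {m} {n} m≢n with m ≡ᵇ n in eq
... | false = refl
... | true  = ⊥-elim (m≢n (≡ᵇ-true⇒≡ eq))

≡ᵇ-refl : ∀ n → (n ≡ᵇ n) ≡ true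
≡ᵇ-refl n = Equivalence.to T-≡ (≡⇒≡ᵇ n n refl)

ι-not : ∀ b → ι b + ι (not b) ≡ 1
ι-not true  = refl
ι-not false = refl

allᵇ-≢⇒All : ∀ x xs → T (allᵇ (λ y → not (x ≡ᵇ y)) xs) → All (x ≢_) xs
allᵇ-≢⇒All x []       _ = []
allᵇ-≢⇒All x (y ∷ ys) t with x ≡ᵇ y in e
... | false = (λ x≡y → subst T e (≡⇒≡ᵇ x y x≡y)) ∷ allᵇ-≢⇒All x ys t
... | true  = ⊥-elim t

All⇒allᵇ-≢ : ∀ x xs → All (x ≢_) xs → T (allᵇ (λ y → not (x ≡ᵇ y)) xs)
All⇒allᵇ-≢ x []       []           = _
All⇒allᵇ-≢ x (y ∷ ys) (x≢y ∷ x∉ys) with x ≡ᵇ y in e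
... | false = All⇒allᵇ-≢ x ys x∉ys
... | true  = x≢y (≡ᵇ-true⇒≡ e)

distinct⇒Unique : ∀ xs → T (distinct xs) → Unique xs
distinct⇒Unique []       _ = []
distinct⇒Unique (x ∷ xs) t with x∉xs , dxs ← Equivalence.to (T-∧ {allᵇ (λ y → not (x ≡ᵇ y)) xs}) t =
  allᵇ-≢⇒All x xs x∉xs ∷ distinct⇒Unique xs dxs

Unique⇒distinct : ∀ xs → Unique xs → T (distinct xs)
Unique⇒distinct []       []           = _
Unique⇒distinct (x ∷ xs) (x∉xs ∷ uxs) =
  Equivalence.from T-∧ (All⇒allᵇ-≢ x xs x∉xs , Unique⇒distinct xs uxs)

∈-toList-allFin : ∀ {m} (i : Fin m) → i ∈ toList (allFin m)
∈-toList-allFin {m} i = subst (i ∈_) (sym (toList-tabulate {m = m} (λ i → i))) (∈-allFin i)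

toList-allFin-Unique : ∀ m → Unique (toList (allFin m))
toList-allFin-Unique m = subst Unique (sym (toList-tabulate {m = m} (λ i → i))) (Unique.allFin⁺ m)

∈-allVecs : ∀ (xs : List A) → (∀ x → x ∈ xs) → ∀ n (v : Vec A n) → v ∈ allVecs xs n
∈-allVecs xs ∈xs zero    []ᵥ       = here refl
∈-allVecs xs ∈xs (suc n) (y ∷ᵥ v) = ∈-concatMap⁺ (λ x → map (x ∷ᵥ_) (allVecs xs n)) {xs = xs}
  (Any.map (λ { refl → ∈-map⁺ (y ∷ᵥ_) (∈-allVecs xs ∈xs n v) }) (∈xs y))

allVecs-Unique : ∀ (xs : List A) → Unique xs → ∀ n → Unique (allVecs xs n)
allVecs-Unique xs uxs zero    = [] ∷ []
allVecs-Unique xs uxs (suc n) =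
  concatMap-Unique (λ x → map (x ∷ᵥ_) (allVecs xs n)) xs Vec.head (λ x → x) (λ e → e) uxs
    (λ x _ → Unique.map⁺ Vec.∷-injectiveʳ (allVecs-Unique xs uxs n))
    (λ x _ v v∈ → head-∈ x v v∈)
  where
    head-∈ : ∀ x v → v ∈ map (x ∷ᵥ_) (allVecs xs n) → Vec.head v ≡ x
    head-∈ x v v∈ with _ , _ , refl ← ∈-map⁻ (x ∷ᵥ_) v∈ = refl

-- Coloured permutations as lists of letters

module Words (a : ℕ) where

  Letter : Set
  Letter = Fin a × ℕ

  AllBelow : ℕ → List Letter → Set
  AllBelow n = All ((_< n) ∘ proj₂)

  insertBefore : Letter → List Letter → List (List Letter)
  insertBefore x []       = []
  insertBefore x (y ∷ ys) = (x ∷ y ∷ ys) ∷ map (y ∷_) (insertBefore x ys)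

  insertions : Letter → List Letter → List (List Letter)
  insertions x []       = (x ∷ []) ∷ []
  insertions x (y ∷ ys) = (x ∷ y ∷ ys) ∷ map (y ∷_) (insertions x ys)

  insertions≡ : ∀ x w → insertions x w ≡ insertBefore x w ++ (w ++ x ∷ []) ∷ []
  insertions≡ x []       = refl
  insertions≡ x (y ∷ ys) = cong ((x ∷ y ∷ ys) ∷_)
    (trans (cong (map (y ∷_)) (insertions≡ x ys)) (map-++ (y ∷_) (insertBefore x ys) _))

  insertBefore⊆insertions : ∀ x w {v} → v ∈ insertBefore x w → v ∈ insertions x w
  insertBefore⊆insertions x w v∈ rewrite insertions≡ x w = ∈-++⁺ˡ v∈

  append∈insertions : ∀ x w → (w ++ x ∷ []) ∈ insertions x w
  append∈insertions x w rewrite insertions≡ x w = ∈-++⁺ʳ (insertBefore x w) (here refl)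

  length-insertBefore : ∀ x w → length (insertBefore x w) ≡ length w
  length-insertBefore x []       = refl
  length-insertBefore x (y ∷ ys) =
    cong suc (trans (length-map (y ∷_) (insertBefore x ys)) (length-insertBefore x ys))

  colours : List (Fin a)
  colours = toList (allFin a)

  insertTop : ℕ → List Letter → List (List Letter)
  insertTop n w = concatMap (λ c → insertions (c , n) w) colours

  words : ℕ → List (List Letter)
  words zero    = [] ∷ []
  words (suc n) = concatMap (insertTop n) (words n)

  IsWord : ℕ → List Letter → Set
  IsWord n w = AllBelow n w × length w ≡ n × Unique (map proj₂ w)

  insertions-↭ : ∀ x w {v} → v ∈ insertions x w → v ↭ x ∷ w
  insertions-↭ x []       (here refl) = ↭-refl
  insertions-↭ x (y ∷ ys) (here refl) = ↭-refl
  insertions-↭ x (y ∷ ys) (there v∈)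
    with v′ , v′∈ , refl ← ∈-map⁻ (y ∷_) v∈ = ↭-trans (prep y (insertions-↭ x ys v′∈)) (swap y x ↭-refl)

  ∈-insertTop⁻ : ∀ n w {v} → v ∈ insertTop n w → ∃ λ c → v ∈ insertions (c , n) w
  ∈-insertTop⁻ n w v∈
    with c , _ , v∈′ ← find (∈-concatMap⁻ (λ c → insertions (c , n) w) {xs = colours} v∈) = c , v∈′

  ∈-words-suc⁻ : ∀ n {v} → v ∈ words (suc n) → ∃ λ w → w ∈ words n × ∃ λ c → v ∈ insertions (c , n) w
  ∈-words-suc⁻ n v∈
    with w , w∈ , v∈′ ← find (∈-concatMap⁻ (insertTop n) v∈) = w , w∈ , ∈-insertTop⁻ n w v∈′

  IsWord-insertions : ∀ {n} c w → IsWord n w → ∀ v → v ∈ insertions (c , n) w → IsWord (suc n) v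
  IsWord-insertions {n} c w (w-below , len , uw) v v∈ =
      All-resp-↭ (↭-sym v↭) (≤-refl ∷ All.map m≤n⇒m≤1+n w-below)
    , trans (↭.↭-length v↭) (cong suc len)
    , Unique-resp-↭ (↭-sym (↭.map⁺ proj₂ v↭)) (n∉ ∷ uw)
    where
      v↭ = insertions-↭ (c , n) w v∈
      n∉ : All (n ≢_) (map proj₂ w)
      n∉ = All-map⁺ (All.map (λ j<n n≡j → <-irrefl (sym n≡j) j<n) w-below)

  words-IsWord : ∀ n w → w ∈ words n → IsWord n w
  words-IsWord zero    _ (here refl) = [] , refl , []
  words-IsWord (suc n) v v∈ with w , w∈ , c , v∈′ ← ∈-words-suc⁻ n v∈ =
    IsWord-insertions c w (words-IsWord n w w∈) v v∈′

  ∈-allPairs : ∀ n (p : Fin a × Fin n) → p ∈ allPairs a n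
  ∈-allPairs n (c , i) = ∈-concatMap⁺ (λ c → map (c ,_) (toList (allFin n))) {xs = toList (allFin a)}
    (Any.map (λ { refl → ∈-map⁺ (c ,_) (∈-toList-allFin i) }) (∈-toList-allFin c))

  allPairs-Unique : ∀ n → Unique (allPairs a n)
  allPairs-Unique n =
    concatMap-Unique (λ c → map (c ,_) (toList (allFin n))) (toList (allFin a)) proj₁ (λ c → c) (λ e → e)
      (toList-allFin-Unique a)
      (λ c _ → Unique.map⁺ (cong proj₂) (toList-allFin-Unique n))
      (λ c _ v v∈ → colour-∈ c v v∈)
    where
      colour-∈ : ∀ c v → v ∈ map (c ,_) (toList (allFin n)) → proj₁ v ≡ c
      colour-∈ c v v∈ with _ , _ , refl ← ∈-map⁻ (c ,_) v∈ = refl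

  lettersᵥ : ∀ {n m} → Vec (Fin a × Fin n) m → List Letter
  lettersᵥ v = map (λ p → proj₁ p , toℕ (proj₂ p)) (toList v)

  lettersᵥ-injective : ∀ {n m} {v w : Vec (Fin a × Fin n) m} → lettersᵥ v ≡ lettersᵥ w → v ≡ w
  lettersᵥ-injective {v = []ᵥ} {[]ᵥ} _ = refl
  lettersᵥ-injective {v = (c , i) ∷ᵥ v} {(c′ , i′) ∷ᵥ w} e with e₁ , e₂ ← ∷-injective e =
    cong₂ _∷ᵥ_ (cong₂ _,_ (cong proj₁ e₁) (toℕ-injective (cong proj₂ e₁))) (lettersᵥ-injective e₂)

  wreath-letters-Unique : ∀ n → Unique (map letters (wreath a n))
  wreath-letters-Unique n = Unique.map⁺ lettersᵥ-injective
    (Unique.filter⁺ (λ w → T? (distinct (map proj₂ (letters w)))) (allVecs-Unique _ (allPairs-Unique n) n))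

  lettersᵥ-IsWord : ∀ {n} (v : Vec (Fin a × Fin n) n) → T (distinct (map proj₂ (lettersᵥ v))) →
                    IsWord n (lettersᵥ v)
  lettersᵥ-IsWord {n} v d = below v , length-lettersᵥ v , distinct⇒Unique _ d
    where
      below : ∀ {m} (v : Vec (Fin a × Fin n) m) → AllBelow n (lettersᵥ v)
      below []ᵥ             = []
      below ((c , i) ∷ᵥ v) = toℕ<n i ∷ below v
      length-lettersᵥ : ∀ {m} (v : Vec (Fin a × Fin n) m) → length (lettersᵥ v) ≡ m
      length-lettersᵥ []ᵥ       = refl
      length-lettersᵥ (_ ∷ᵥ v) = cong suc (length-lettersᵥ v)

  ∈wreath⇒IsWord : ∀ n l → l ∈ map letters (wreath a n) → IsWord n l
  ∈wreath⇒IsWord n l l∈ with w , w∈ , refl ← ∈-map⁻ letters l∈ =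
    lettersᵥ-IsWord w (proj₂ (∈-filter⁻ (λ w → T? (distinct (map proj₂ (letters w))))
                                        {xs = allVecs (allPairs a n) n} w∈))

  fromLetters : ∀ {n} (l : List Letter) → AllBelow n l → Vec (Fin a × Fin n) (length l)
  fromLetters []            []          = []ᵥ
  fromLetters ((c , i) ∷ l) (i<n ∷ l<n) = (c , fromℕ< i<n) ∷ᵥ fromLetters l l<n

  lettersᵥ-fromLetters : ∀ {n} (l : List Letter) (l<n : AllBelow n l) → lettersᵥ (fromLetters l l<n) ≡ l
  lettersᵥ-fromLetters []            []          = refl
  lettersᵥ-fromLetters ((c , i) ∷ l) (i<n ∷ l<n) =
    cong₂ _∷_ (cong (c ,_) (toℕ-fromℕ< i<n)) (lettersᵥ-fromLetters l l<n)

  IsWord⇒∈wreath : ∀ n l → IsWord n l → l ∈ map letters (wreath a n)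
  IsWord⇒∈wreath .(length l) l (l<n , refl , ul) =
    subst (_∈ map letters (wreath a (length l))) (lettersᵥ-fromLetters l l<n)
      (∈-map⁺ letters (∈-filter⁺ (λ w → T? (distinct (map proj₂ (letters w))))
        (∈-allVecs (allPairs a (length l)) (∈-allPairs (length l)) (length l) w)
        (subst (T ∘ distinct ∘ map proj₂) (sym (lettersᵥ-fromLetters l l<n)) (Unique⇒distinct _ ul))))
    where w = fromLetters l l<n

  middle∈insertions : ∀ x pre post → (pre ++ x ∷ post) ∈ insertions x (pre ++ post)
  middle∈insertions x []        []       = here refl
  middle∈insertions x []        (_ ∷ _)  = here refl
  middle∈insertions x (y ∷ pre) post     = there (∈-map⁺ (y ∷_) (middle∈insertions x pre post))

  -- By pigeonhole a word of length n + 1 contains the value n; deleting it gives a word of length n.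
  IsWord⇒∈words : ∀ n l → IsWord n l → l ∈ words n
  IsWord⇒∈words zero [] _ = here refl
  IsWord⇒∈words (suc n) l (l<n , len , ul)
    with (c , _) , n∈l , refl ←
           ∈-map⁻ proj₂ (Unique-full⇒max∈ n ul (All-map⁺ l<n) (trans (length-map proj₂ l) len))
    with pre , post , refl ← ∈-∃++ n∈l =
      ∈-concatMap⁺ (insertTop n) {xs = words n}
        (Any.map (λ { refl → ∈-concatMap⁺ (λ c → insertions (c , n) w) {xs = colours}
                               (Any.map (λ { refl → middle∈insertions (c , n) pre post }) (∈-toList-allFin c)) })
                 (IsWord⇒∈words n w (w<n , w-length , AllPairs.tail u′)))
    where
      w = pre ++ post
      l↭ : pre ++ (c , n) ∷ post ↭ (c , n) ∷ w
      l↭ = ↭.shift (c , n) pre post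
      u′ : Unique (n ∷ map proj₂ w)
      u′ = Unique-resp-↭ (↭.map⁺ proj₂ l↭) ul
      w<n : AllBelow n w
      w<n = All-map⁻ (below-∉ (All.tail (All-map⁺ (All-resp-↭ l↭ l<n))) (Unique.Unique[x∷xs]⇒x∉xs u′))
      w-length : length w ≡ n
      w-length = suc-injective (trans (sym (↭.↭-length l↭)) len)

  colourOf : ℕ → List Letter → Maybe (Fin a)
  colourOf n []            = nothing
  colourOf n ((c , i) ∷ l) = if i ≡ᵇ n then just c else colourOf n l

  removeValue : ℕ → List Letter → List Letter
  removeValue n []            = []
  removeValue n ((c , i) ∷ l) = if i ≡ᵇ n then removeValue n l else (c , i) ∷ removeValue n l

  colourOf-insertions : ∀ {n} c w → AllBelow n w → ∀ v → v ∈ insertions (c , n) w → colourOf n v ≡ just c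
  colourOf-insertions {n} c []       _ _ (here refl) rewrite ≡ᵇ-refl n = refl
  colourOf-insertions {n} c (_ ∷ _)  _ _ (here refl) rewrite ≡ᵇ-refl n = refl
  colourOf-insertions c ((c₀ , j) ∷ ys) (j<n ∷ ys<n) _ (there v∈)
    with v′ , v′∈ , refl ← ∈-map⁻ ((c₀ , j) ∷_) v∈ rewrite ≢⇒≡ᵇ-false (<⇒≢ j<n) =
      colourOf-insertions c ys ys<n v′ v′∈

  removeValue-below : ∀ {n} w → AllBelow n w → removeValue n w ≡ w
  removeValue-below []            []          = refl
  removeValue-below ((c , j) ∷ w) (j<n ∷ w<n) rewrite ≢⇒≡ᵇ-false (<⇒≢ j<n) =
    cong ((c , j) ∷_) (removeValue-below w w<n)

  removeValue-insertions : ∀ {n} c w → AllBelow n w → ∀ v → v ∈ insertions (c , n) w → removeValue n v ≡ w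
  removeValue-insertions {n} c []       _    _ (here refl) rewrite ≡ᵇ-refl n = refl
  removeValue-insertions {n} c (y ∷ ys) ys<n _ (here refl) rewrite ≡ᵇ-refl n = removeValue-below (y ∷ ys) ys<n
  removeValue-insertions c ((c₀ , j) ∷ ys) (j<n ∷ ys<n) _ (there v∈)
    with v′ , v′∈ , refl ← ∈-map⁻ ((c₀ , j) ∷_) v∈ rewrite ≢⇒≡ᵇ-false (<⇒≢ j<n) =
      cong ((c₀ , j) ∷_) (removeValue-insertions c ys ys<n v′ v′∈)

  insertions-Unique : ∀ {n} c w → AllBelow n w → Unique (insertions (c , n) w)
  insertions-Unique c []               _            = [] ∷ []
  insertions-Unique {n} c ((c₀ , j) ∷ ys) (j<n ∷ ys<n) =
    All.tabulate front-new ∷ Unique.map⁺ ∷-injectiveʳ (insertions-Unique c ys ys<n)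
    where
      front-new : ∀ {z} → z ∈ map ((c₀ , j) ∷_) (insertions (c , n) ys) → (c , n) ∷ (c₀ , j) ∷ ys ≢ z
      front-new z∈ e with _ , _ , refl ← ∈-map⁻ ((c₀ , j) ∷_) z∈ =
        <⇒≢ j<n (sym (cong proj₂ (∷-injectiveˡ e)))

  -- The top letter of an inserted word recovers both the colour and the word it was inserted into.
  words-Unique : ∀ n → Unique (words n)
  words-Unique zero    = [] ∷ []
  words-Unique (suc n) =
    concatMap-Unique (insertTop n) (words n) (removeValue n) (λ w → w) (λ e → e) (words-Unique n)
      (λ w w∈ → concatMap-Unique (λ c → insertions (c , n) w) colours (colourOf n) just just-injective
                  (toList-allFin-Unique a)
                  (λ c _ → insertions-Unique c w (w<n w∈))
                  (λ c _ → colourOf-insertions c w (w<n w∈)))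
      (λ w w∈ v v∈ → let c , v∈′ = ∈-insertTop⁻ n w v∈ in removeValue-insertions c w (w<n w∈) v v∈′)
    where
      w<n : ∀ {w} → w ∈ words n → AllBelow n w
      w<n {w} w∈ = proj₁ (words-IsWord n w w∈)

  wreath↭words : ∀ n → map letters (wreath a n) ↭ words n
  wreath↭words n = sameMembers-Unique⇒↭ _ _ (wreath-letters-Unique n) (words-Unique n)
    (λ l l∈ → IsWord⇒∈words n l (∈wreath⇒IsWord n l l∈))
    (λ l l∈ → IsWord⇒∈wreath n l (words-IsWord n l l∈))

-- Descents and right-to-left minima under insertion of the maximum

module Statistics (a : ℕ) (L : Subset a) where

  open Words a

  point : Letter → Pt a
  point p = pt (proj₁ p) (proj₂ p)

  _<ₗ_ : Pt a → Pt a → Bool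
  x <ₗ y = _<L_ {L = L} x y

  rlmin : List Letter → ℕ
  rlmin = rlminL-list L

  des : Pt a → List Letter → ℕ
  des prev w = descents L (prev ∷ map point w)

  Below : ℕ → Pt a → Set
  Below n origin   = ⊤
  Below n (pt _ i) = i < n

  top<ₗ-below : ∀ {n prev} c → Below n prev → (pt c n <ₗ prev) ≡ inL L c
  top<ₗ-below {prev = origin}  c _   = refl
  top<ₗ-below {prev = pt u i} c i<n with inL L c | inL L u
  ... | true  | true  = <ᵇ-true i<n
  ... | false | false = <ᵇ-false i<n
  ... | true  | false = refl
  ... | false | true  = refl

  below<ₗ-top : ∀ {n j} c v → j < n → (pt v j <ₗ pt c n) ≡ not (inL L c)
  below<ₗ-top c v j<n with inL L v | inL L c
  ... | true  | true  = <ᵇ-false j<n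
  ... | false | false = <ᵇ-true j<n
  ... | true  | false = refl
  ... | false | true  = refl

  -- Exactly one of the two comparisons around a new maximum is an L-descent.
  des-insert-top : ∀ {n prev j} c v ys → Below n prev → j < n →
    des prev ((c , n) ∷ (v , j) ∷ ys) ≡ suc (des (pt v j) ys)
  des-insert-top {n} {prev} {j} c v ys below j<n = begin
    ι (pt c n <ₗ prev) + (ι (pt v j <ₗ pt c n) + des (pt v j) ys)
      ≡⟨ +-assoc (ι (pt c n <ₗ prev)) _ _ ⟨
    ι (pt c n <ₗ prev) + ι (pt v j <ₗ pt c n) + des (pt v j) ys
      ≡⟨ cong₂ (λ x y → ι x + ι y + des (pt v j) ys) (top<ₗ-below c below) (below<ₗ-top c v j<n) ⟩
    ι (inL L c) + ι (not (inL L c)) + des (pt v j) ys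
      ≡⟨ cong (_+ des (pt v j) ys) (ι-not (inL L c)) ⟩
    suc (des (pt v j) ys) ∎
    where open ≡-Reasoning

  -- Inserting the maximum into a descent slot keeps the descent number and into any
  -- other slot raises it by one; the identity counts this without subtraction.
  des-insertBefore-sum : ∀ {n prev} c w → Below n prev → AllBelow n w → (h : ℕ → ℕ) →
    sum (map (h ∘ des prev) (insertBefore (c , n) w)) + des prev w * h (suc (des prev w))
      ≡ des prev w * h (des prev w) + length w * h (suc (des prev w))
  des-insertBefore-sum c [] below _ h = refl
  des-insertBefore-sum {n} {prev} c ((v , j) ∷ ys) below (j<n ∷ ys-below) h
    rewrite des-insert-top c v ys below j<n
          | sym (map-∘ {g = h ∘ des prev} {f = (v , j) ∷_} (insertBefore (c , n) ys))
    with pt v j <ₗ prev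
  ... | true  = descent-slot (des (pt v j) ys) (length ys) _ _ _
                  (des-insertBefore-sum c ys j<n ys-below (h ∘ suc))
    where
      descent-slot : ∀ D m H₁ H₂ S → S + D * H₂ ≡ D * H₁ + m * H₂ →
                     H₁ + S + suc D * H₂ ≡ suc D * H₁ + suc m * H₂
      descent-slot D m H₁ H₂ S ih = begin
        H₁ + S + suc D * H₂         ≡⟨ solve 4 (λ D H₁ H₂ S → H₁ :+ S :+ (con 1 :+ D) :* H₂
                                                 := H₁ :+ H₂ :+ (S :+ D :* H₂)) refl D H₁ H₂ S ⟩
        H₁ + H₂ + (S + D * H₂)      ≡⟨ cong (H₁ + H₂ +_) ih ⟩
        H₁ + H₂ + (D * H₁ + m * H₂) ≡⟨ solve 4 (λ D m H₁ H₂ → H₁ :+ H₂ :+ (D :* H₁ :+ m :* H₂)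
                                                 := (con 1 :+ D) :* H₁ :+ (con 1 :+ m) :* H₂) refl D m H₁ H₂ ⟩
        suc D * H₁ + suc m * H₂     ∎
        where
          open ≡-Reasoning
          open ℕSolver
  ... | false = ascent-slot (des (pt v j) ys) (length ys) _ _ _
                  (des-insertBefore-sum c ys j<n ys-below h)
    where
      ascent-slot : ∀ D m H₀ H₁ S → S + D * H₁ ≡ D * H₀ + m * H₁ →
                    H₁ + S + D * H₁ ≡ D * H₀ + suc m * H₁
      ascent-slot D m H₀ H₁ S ih = begin
        H₁ + S + D * H₁        ≡⟨ +-assoc H₁ S (D * H₁) ⟩
        H₁ + (S + D * H₁)      ≡⟨ cong (H₁ +_) ih ⟩
        H₁ + (D * H₀ + m * H₁) ≡⟨ solve 4 (λ D m H₀ H₁ → H₁ :+ (D :* H₀ :+ m :* H₁)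
                                            := D :* H₀ :+ (con 1 :+ m) :* H₁) refl D m H₀ H₁ ⟩
        D * H₀ + suc m * H₁    ∎
        where
          open ≡-Reasoning
          open ℕSolver

  des-append-top : ∀ {n prev} c w → Below n prev → AllBelow n w →
    des prev (w ++ (c , n) ∷ []) ≡ des prev w + ι (inL L c)
  des-append-top c [] below _ = trans (+-identityʳ _) (cong ι (top<ₗ-below c below))
  des-append-top {prev = prev} c ((v , j) ∷ ys) _ (j<n ∷ ys-below) =
    trans (cong (ι (pt v j <ₗ prev) +_) (des-append-top c ys j<n ys-below))
          (sym (+-assoc (ι (pt v j <ₗ prev)) (des (pt v j) ys) (ι (inL L c))))

  des-insertBefore-≥ : ∀ {n prev} c w → Below n prev → AllBelow n w →
    ∀ v → v ∈ insertBefore (c , n) w → des prev w ≤ des prev v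
  des-insertBefore-≥ {prev = prev} c ((v , j) ∷ ys) below (j<n ∷ _) _ (here refl)
    rewrite des-insert-top c v ys below j<n = +-monoˡ-≤ (des (pt v j) ys) (ι≤1 (pt v j <ₗ prev))
    where
      ι≤1 : ∀ b → ι b ≤ 1
      ι≤1 true  = s≤s z≤n
      ι≤1 false = z≤n
  des-insertBefore-≥ {prev = prev} c ((v , j) ∷ ys) _ (j<n ∷ ys-below) _ (there v∈)
    with v′ , v′∈ , refl ← ∈-map⁻ ((v , j) ∷_) v∈ =
      +-monoʳ-≤ (ι (pt v j <ₗ prev)) (des-insertBefore-≥ c ys j<n ys-below v′ v′∈)

  allᵇ-insertions : ∀ (p : Letter → Bool) x w → p x ≡ true →
    ∀ v → v ∈ insertions x w → allᵇ p v ≡ allᵇ p w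
  allᵇ-insertions p x []       px _ (here refl) rewrite px = refl
  allᵇ-insertions p x (y ∷ ys) px _ (here refl) rewrite px = refl
  allᵇ-insertions p x (y ∷ ys) px _ (there v∈)
    with v′ , v′∈ , refl ← ∈-map⁻ (y ∷_) v∈ = cong (p y ∧_) (allᵇ-insertions p x ys px v′ v′∈)

  rlmin-insertBefore : ∀ {n} c w → AllBelow n w → ∀ v → v ∈ insertBefore (c , n) w → rlmin v ≡ rlmin w
  rlmin-insertBefore {n} c ((v , j) ∷ ys) (j<n ∷ _) _ (here refl)
    rewrite <ᵇ-false {n} {j} j<n | ∧-zeroʳ (inL L c) = refl
  rlmin-insertBefore {n} c ((v , j) ∷ ys) (j<n ∷ ys-below) _ (there v∈)
    with v′ , v′∈ , refl ← ∈-map⁻ ((v , j) ∷_) v∈ =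
      cong₂ _+_ (cong (λ b → ι (inL L v ∧ b))
                  (allᵇ-insertions (λ y → j <ᵇ proj₂ y) (c , n) ys (<ᵇ-true j<n) v′
                    (insertBefore⊆insertions (c , n) ys v′∈)))
                (rlmin-insertBefore c ys ys-below v′ v′∈)

  rlmin-append-top : ∀ {n} c w → AllBelow n w → rlmin (w ++ (c , n) ∷ []) ≡ rlmin w + ι (inL L c)
  rlmin-append-top c [] _ rewrite ∧-identityʳ (inL L c) = +-identityʳ _
  rlmin-append-top {n} c ((v , j) ∷ ys) (j<n ∷ ys-below) =
    trans (cong₂ _+_ (cong (λ b → ι (inL L v ∧ b))
                       (allᵇ-insertions (λ y → j <ᵇ proj₂ y) (c , n) ys (<ᵇ-true j<n) _
                         (append∈insertions (c , n) ys)))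
                     (rlmin-append-top c ys ys-below))
          (sym (+-assoc (ι (inL L v ∧ allᵇ (λ y → j <ᵇ proj₂ y) ys)) (rlmin ys) _))

  minIs : ℕ → List Letter → Bool
  minIs k w = rlmin w ≡ᵇ k

  desMinIs : ℕ → List Letter → Bool
  desMinIs k w = (des origin w ≡ᵇ k) ∧ (rlmin w ≡ᵇ k)

  count-insertions : ∀ (q : List Letter → Bool) x w →
    count q (insertions x w) ≡ sum (map (ι ∘ q) (insertBefore x w)) + ι (q (w ++ x ∷ []))
  count-insertions q x w = begin
    count q (insertions x w)
      ≡⟨ count≡sum q (insertions x w) ⟩
    sum (map (ι ∘ q) (insertions x w))
      ≡⟨ cong (sum ∘ map (ι ∘ q)) (insertions≡ x w) ⟩
    sum (map (ι ∘ q) (insertBefore x w ++ (w ++ x ∷ []) ∷ []))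
      ≡⟨ cong sum (map-++ (ι ∘ q) (insertBefore x w) _) ⟩
    sum (map (ι ∘ q) (insertBefore x w) ++ ι (q (w ++ x ∷ [])) ∷ [])
      ≡⟨ sum-++ (map (ι ∘ q) (insertBefore x w)) _ ⟩
    sum (map (ι ∘ q) (insertBefore x w)) + (ι (q (w ++ x ∷ [])) + 0)
      ≡⟨ cong (sum (map (ι ∘ q) (insertBefore x w)) +_) (+-identityʳ _) ⟩
    sum (map (ι ∘ q) (insertBefore x w)) + ι (q (w ++ x ∷ [])) ∎
    where open ≡-Reasoning

  count-minIs-insertions : ∀ {n} c w k → AllBelow n w →
    count (minIs k) (insertions (c , n) w)
      ≡ length w * ι (minIs k w) + ι (rlmin w + ι (inL L c) ≡ᵇ k)
  count-minIs-insertions {n} c w k w-below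
    rewrite count-insertions (minIs k) (c , n) w | rlmin-append-top c w w-below =
      cong (_+ ι (rlmin w + ι (inL L c) ≡ᵇ k)) (begin
        sum (map (ι ∘ minIs k) (insertBefore (c , n) w))
          ≡⟨ sum-cong-∈ _ (λ _ → ι (minIs k w)) (insertBefore (c , n) w)
               (λ v v∈ → cong (λ r → ι (r ≡ᵇ k)) (rlmin-insertBefore c w w-below v v∈)) ⟩
        sum (map (λ _ → ι (minIs k w)) (insertBefore (c , n) w))
          ≡⟨ sum-map-const (ι (minIs k w)) (insertBefore (c , n) w) ⟩
        length (insertBefore (c , n) w) * ι (minIs k w)
          ≡⟨ cong (_* ι (minIs k w)) (length-insertBefore (c , n) w) ⟩
        length w * ι (minIs k w) ∎)
    where open ≡-Reasoning

  -- Needs rlmin ≤ des: an insertion that raises des can then never give des = rlmin = k.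
  count-desMinIs-insertions : ∀ {n} c w k → AllBelow n w → rlmin w ≤ des origin w →
    count (desMinIs k) (insertions (c , n) w)
      ≡ k * ι (desMinIs k w) + ι ((des origin w + ι (inL L c) ≡ᵇ k) ∧ (rlmin w + ι (inL L c) ≡ᵇ k))
  count-desMinIs-insertions {n} c w k w-below r≤D
    rewrite count-insertions (desMinIs k) (c , n) w | rlmin-append-top c w w-below
          | des-append-top c w tt w-below =
      cong (_+ ι ((D + ι (inL L c) ≡ᵇ k) ∧ (r + ι (inL L c) ≡ᵇ k))) (begin
        sum (map (ι ∘ desMinIs k) front)
          ≡⟨ sum-cong-∈ _ (h ∘ des origin) front
               (λ v v∈ → cong (λ r′ → ι ((des origin v ≡ᵇ k) ∧ (r′ ≡ᵇ k)))
                              (rlmin-insertBefore c w w-below v v∈)) ⟩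
        S                                    ≡⟨ +-identityʳ S ⟨
        S + 0                                ≡⟨ cong (S +_) (*-zeroʳ D) ⟨
        S + D * 0                            ≡⟨ cong (λ z → S + D * z) h-above ⟨
        S + D * h (suc D)                    ≡⟨ des-insertBefore-sum c w tt w-below h ⟩
        D * h D + length w * h (suc D)       ≡⟨ cong (λ z → D * h D + length w * z) h-above ⟩
        D * h D + length w * 0               ≡⟨ cong (D * h D +_) (*-zeroʳ (length w)) ⟩
        D * h D + 0                          ≡⟨ +-identityʳ _ ⟩
        D * h D                              ≡⟨ h-scale ⟩
        k * h D                              ∎)
    where
      open ≡-Reasoning
      D = des origin w
      r = rlmin w
      front = insertBefore (c , n) w
      h : ℕ → ℕ
      h d = ι ((d ≡ᵇ k) ∧ (r ≡ᵇ k))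
      S = sum (map (h ∘ des origin) front)
      h-above : h (suc D) ≡ 0
      h-above with r ≡ᵇ k in r≡k
      ... | false rewrite ∧-zeroʳ (suc D ≡ᵇ k) = refl
      ... | true  rewrite ∧-identityʳ (suc D ≡ᵇ k)
                        | ≢⇒≡ᵇ-false {suc D} {k} (λ e → <-irrefl (trans (≡ᵇ-true⇒≡ r≡k) (sym e)) (s≤s r≤D))
                        = refl
      h-scale : D * h D ≡ k * h D
      h-scale with D ≡ᵇ k in D≡k
      ... | false = trans (*-zeroʳ D) (sym (*-zeroʳ k))
      ... | true  = cong (_* ι (r ≡ᵇ k)) (≡ᵇ-true⇒≡ {D} {k} D≡k)

  ℓ u : ℕ
  ℓ = ∣ L ∣
  u = ∣ ∁ L ∣

  sum-over-colours : (F : Bool → ℕ) → sum (map (F ∘ inL L) colours) ≡ ℓ * F true + u * F false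
  sum-over-colours F = begin
    sum (map (F ∘ inL L) (toList (allFin a)))  ≡⟨ cong (sum ∘ map (F ∘ inL L)) (toList-tabulate (λ c → c)) ⟩
    sum (map (F ∘ inL L) (List.tabulate (λ c → c))) ≡⟨ cong sum (map-tabulate (λ c → c) (F ∘ inL L)) ⟩
    sum (List.tabulate (F ∘ lookup L))         ≡⟨ sum-subset L ⟩
    ℓ * F true + u * F false                   ∎
    where
      open ≡-Reasoning
      sum-subset : ∀ {m} (p : Subset m) → sum (List.tabulate (F ∘ lookup p)) ≡ ∣ p ∣ * F true + ∣ ∁ p ∣ * F false
      sum-subset []ᵥ             = refl
      sum-subset (true ∷ᵥ p)  rewrite sum-subset p = sym (+-assoc (F true) (∣ p ∣ * F true) _)
      sum-subset (false ∷ᵥ p) rewrite sum-subset p =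
        solve 4 (λ A B P U → B :+ (P :* A :+ U :* B) := P :* A :+ (B :+ U :* B)) refl
          (F true) (F false) ∣ p ∣ ∣ ∁ p ∣
        where open ℕSolver

  -- u + a j: the insertions of the maximum that leave the statistic counted by j unchanged.
  neutral : ℕ → ℕ
  neutral j = u + (ℓ + u) * j

  count-minIs-insertTop : ∀ n w k → AllBelow n w → length w ≡ n →
    count (minIs k) (insertTop n w) ≡ ℓ * ι (suc (rlmin w) ≡ᵇ k) + neutral n * ι (minIs k w)
  count-minIs-insertTop n w k w-below len = begin
    count (minIs k) (insertTop n w)
      ≡⟨ count-concatMap (minIs k) (λ c → insertions (c , n) w) colours ⟩
    sum (map (λ c → count (minIs k) (insertions (c , n) w)) colours)
      ≡⟨ sum-cong-∈ _ (F ∘ inL L) colours (λ c _ →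
           trans (count-minIs-insertions c w k w-below) (cong (λ m → m * i₀ + _) len)) ⟩
    sum (map (F ∘ inL L) colours)
      ≡⟨ sum-over-colours F ⟩
    ℓ * (n * i₀ + ι (r + 1 ≡ᵇ k)) + u * (n * i₀ + ι (r + 0 ≡ᵇ k))
      ≡⟨ cong₂ (λ x y → ℓ * (n * i₀ + ι (x ≡ᵇ k)) + u * (n * i₀ + ι (y ≡ᵇ k)))
               (+-comm r 1) (+-identityʳ r) ⟩
    ℓ * (n * i₀ + i₁) + u * (n * i₀ + i₀)
      ≡⟨ solve 5 (λ l u n i₀ i₁ → l :* (n :* i₀ :+ i₁) :+ u :* (n :* i₀ :+ i₀)
                                  := l :* i₁ :+ (u :+ (l :+ u) :* n) :* i₀) refl ℓ u n i₀ i₁ ⟩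
    ℓ * i₁ + neutral n * i₀ ∎
    where
      open ≡-Reasoning
      open ℕSolver
      r = rlmin w
      i₀ = ι (minIs k w)
      i₁ = ι (suc r ≡ᵇ k)
      F : Bool → ℕ
      F b = n * i₀ + ι (r + ι b ≡ᵇ k)

  count-desMinIs-insertTop : ∀ n w k → AllBelow n w → rlmin w ≤ des origin w →
    count (desMinIs k) (insertTop n w)
      ≡ ℓ * ι ((suc (des origin w) ≡ᵇ k) ∧ (suc (rlmin w) ≡ᵇ k)) + neutral k * ι (desMinIs k w)
  count-desMinIs-insertTop n w k w-below r≤D = begin
    count (desMinIs k) (insertTop n w)
      ≡⟨ count-concatMap (desMinIs k) (λ c → insertions (c , n) w) colours ⟩
    sum (map (λ c → count (desMinIs k) (insertions (c , n) w)) colours)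
      ≡⟨ sum-cong-∈ _ (F ∘ inL L) colours (λ c _ → count-desMinIs-insertions c w k w-below r≤D) ⟩
    sum (map (F ∘ inL L) colours)
      ≡⟨ sum-over-colours F ⟩
    ℓ * F true + u * F false
      ≡⟨ cong₂ (λ x y → ℓ * (k * i₀ + ι x) + u * (k * i₀ + ι y))
           (cong₂ _∧_ (cong (_≡ᵇ k) (+-comm D 1)) (cong (_≡ᵇ k) (+-comm r 1)))
           (cong₂ _∧_ (cong (_≡ᵇ k) (+-identityʳ D)) (cong (_≡ᵇ k) (+-identityʳ r))) ⟩
    ℓ * (k * i₀ + i₁) + u * (k * i₀ + i₀)
      ≡⟨ solve 5 (λ l u k i₀ i₁ → l :* (k :* i₀ :+ i₁) :+ u :* (k :* i₀ :+ i₀)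
                                  := l :* i₁ :+ (u :+ (l :+ u) :* k) :* i₀) refl ℓ u k i₀ i₁ ⟩
    ℓ * i₁ + neutral k * i₀ ∎
    where
      open ≡-Reasoning
      open ℕSolver
      D = des origin w
      r = rlmin w
      i₀ = ι (desMinIs k w)
      i₁ = ι ((suc D ≡ᵇ k) ∧ (suc r ≡ᵇ k))
      F : Bool → ℕ
      F b = k * i₀ + ι ((D + ι b ≡ᵇ k) ∧ (r + ι b ≡ᵇ k))

  words-rlmin≤des : ∀ n w → w ∈ words n → rlmin w ≤ des origin w
  words-rlmin≤des zero    _ (here refl) = z≤n
  words-rlmin≤des (suc n) v v∈ with w , w∈ , c , v∈′ ← ∈-words-suc⁻ n v∈
    with w-below , _ ← words-IsWord n w w∈
    with ∈-++⁻ (insertBefore (c , n) w) (subst (v ∈_) (insertions≡ (c , n) w) v∈′)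
  ... | inj₁ v∈front = subst (_≤ des origin v) (sym (rlmin-insertBefore c w w-below v v∈front))
                         (≤-trans (words-rlmin≤des n w w∈) (des-insertBefore-≥ c w tt w-below v v∈front))
  ... | inj₂ (here refl)
    rewrite rlmin-append-top c w w-below | des-append-top c w tt w-below =
      +-monoˡ-≤ _ (words-rlmin≤des n w w∈)

  minCount desMinCount : ℕ → ℕ → ℕ
  minCount    n k = count (minIs k) (words n)
  desMinCount n k = count (desMinIs k) (words n)

  count-words-suc : ∀ n (q f g : List Letter → Bool) (P Q : ℕ) →
    (∀ w → w ∈ words n → count q (insertTop n w) ≡ P * ι (f w) + Q * ι (g w)) →
    count q (words (suc n)) ≡ P * count f (words n) + Q * count g (words n)
  count-words-suc n q f g P Q step = begin
    count q (concatMap (insertTop n) (words n))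
      ≡⟨ count-concatMap q (insertTop n) (words n) ⟩
    sum (map (λ w → count q (insertTop n w)) (words n))
      ≡⟨ sum-cong-∈ _ _ (words n) step ⟩
    sum (map (λ w → P * ι (f w) + Q * ι (g w)) (words n))
      ≡⟨ sum-map-linear P Q _ _ (words n) ⟩
    P * sum (map (ι ∘ f) (words n)) + Q * sum (map (ι ∘ g) (words n))
      ≡⟨ cong₂ (λ x y → P * x + Q * y) (count≡sum f (words n)) (count≡sum g (words n)) ⟨
    P * count f (words n) + Q * count g (words n) ∎
    where open ≡-Reasoning

  minCount-suc : ∀ n k →
    minCount (suc n) k ≡ ℓ * count (λ w → suc (rlmin w) ≡ᵇ k) (words n) + neutral n * minCount n k
  minCount-suc n k = count-words-suc n (minIs k) _ (minIs k) ℓ (neutral n) λ w w∈ →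
    let w-below , len , _ = words-IsWord n w w∈ in count-minIs-insertTop n w k w-below len

  desMinCount-suc : ∀ n k →
    desMinCount (suc n) k
      ≡ ℓ * count (λ w → (suc (des origin w) ≡ᵇ k) ∧ (suc (rlmin w) ≡ᵇ k)) (words n)
        + neutral k * desMinCount n k
  desMinCount-suc n k = count-words-suc n (desMinIs k) _ (desMinIs k) ℓ (neutral k) λ w w∈ →
    count-desMinIs-insertTop n w k (proj₁ (words-IsWord n w w∈)) (words-rlmin≤des n w w∈)

  minCount-suc-zero : ∀ n → minCount (suc n) 0 ≡ neutral n * minCount n 0
  minCount-suc-zero n = trans (minCount-suc n 0)
    (cong (_+ neutral n * minCount n 0) (trans (cong (ℓ *_) (count-none (words n))) (*-zeroʳ ℓ)))

  minCount-suc-suc : ∀ n k → minCount (suc n) (suc k) ≡ ℓ * minCount n k + neutral n * minCount n (suc k)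
  minCount-suc-suc n k = minCount-suc n (suc k)

  desMinCount-suc-zero : ∀ n → desMinCount (suc n) 0 ≡ neutral 0 * desMinCount n 0
  desMinCount-suc-zero n = trans (desMinCount-suc n 0)
    (cong (_+ neutral 0 * desMinCount n 0) (trans (cong (ℓ *_) (count-none (words n))) (*-zeroʳ ℓ)))

  desMinCount-suc-suc : ∀ n k →
    desMinCount (suc n) (suc k) ≡ ℓ * desMinCount n k + neutral (suc k) * desMinCount n (suc k)
  desMinCount-suc-suc n k = desMinCount-suc n (suc k)

-- Normalisation by powers of ℓ

open import Data.Integer as ℤ using (ℤ; +_)
open import Algebra.Definitions.RawSemiring ℚ.+-*-rawSemiring using (_^_)

fromℚᵘ-homo-+ : ∀ p q → fromℚᵘ (p ℚᵘ.+ q) ≡ fromℚᵘ p ℚ.+ fromℚᵘ q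
fromℚᵘ-homo-+ p q = ℚ.toℚᵘ-injective (ℚᵘ.≃-trans (ℚ.toℚᵘ-fromℚᵘ (p ℚᵘ.+ q))
  (ℚᵘ.≃-sym (ℚᵘ.≃-trans (ℚ.toℚᵘ-homo-+ (fromℚᵘ p) (fromℚᵘ q))
                         (ℚᵘ.+-cong (ℚ.toℚᵘ-fromℚᵘ p) (ℚ.toℚᵘ-fromℚᵘ q)))))

fromℚᵘ-homo-* : ∀ p q → fromℚᵘ (p ℚᵘ.* q) ≡ fromℚᵘ p ℚ.* fromℚᵘ q
fromℚᵘ-homo-* p q = ℚ.toℚᵘ-injective (ℚᵘ.≃-trans (ℚ.toℚᵘ-fromℚᵘ (p ℚᵘ.* q))
  (ℚᵘ.≃-sym (ℚᵘ.≃-trans (ℚ.toℚᵘ-homo-* (fromℚᵘ p) (fromℚᵘ q))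
                         (ℚᵘ.*-cong (ℚ.toℚᵘ-fromℚᵘ p) (ℚ.toℚᵘ-fromℚᵘ q)))))

fromℚᵘ-homo‿- : ∀ p → fromℚᵘ (ℚᵘ.- p) ≡ ℚ.- fromℚᵘ p
fromℚᵘ-homo‿- p = ℚ.toℚᵘ-injective (ℚᵘ.≃-trans (ℚ.toℚᵘ-fromℚᵘ (ℚᵘ.- p))
  (ℚᵘ.≃-sym (ℚᵘ.≃-trans (ℚ.toℚᵘ-homo‿- (fromℚᵘ p)) (ℚᵘ.-‿cong (ℚ.toℚᵘ-fromℚᵘ p)))))

[_] : ℤ → ℚ
[ z ] = z / 1

[]-homo-+ : ∀ x y → [ x ℤ.+ y ] ≡ [ x ] ℚ.+ [ y ]
[]-homo-+ x y = trans (ℚ.fromℚᵘ-cong {mkℚᵘ (x ℤ.+ y) 0} {mkℚᵘ x 0 ℚᵘ.+ mkℚᵘ y 0}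
                        (*≡* (solve 2 (λ x y → (x :+ y) :* con (+ 1) := (x :* con (+ 1) :+ y :* con (+ 1)) :* con (+ 1))
                                      refl x y)))
                      (fromℚᵘ-homo-+ (mkℚᵘ x 0) (mkℚᵘ y 0))
  where open ℤSolver

[]-homo-* : ∀ x y → [ x ℤ.* y ] ≡ [ x ] ℚ.* [ y ]
[]-homo-* x y = fromℚᵘ-homo-* (mkℚᵘ x 0) (mkℚᵘ y 0)

[]-homo‿- : ∀ x → [ ℤ.- x ] ≡ ℚ.- [ x ]
[]-homo‿- x = fromℚᵘ-homo‿- (mkℚᵘ x 0)

[+]-homo-+ : ∀ m n → [ + (m + n) ] ≡ [ + m ] ℚ.+ [ + n ]
[+]-homo-+ m n = trans (cong [_] (ℤ.pos-+ m n)) ([]-homo-+ (+ m) (+ n))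

[+]-homo-* : ∀ m n → [ + (m * n) ] ≡ [ + m ] ℚ.* [ + n ]
[+]-homo-* m n = trans (cong [_] (ℤ.pos-* m n)) ([]-homo-* (+ m) (+ n))

module Scaling (ℓ' : ℕ) where

  ℓ⁻¹ : ℚ
  ℓ⁻¹ = + 1 / suc ℓ'

  ℓ*ℓ⁻¹ : [ + suc ℓ' ] ℚ.* ℓ⁻¹ ≡ 1ℚ
  ℓ*ℓ⁻¹ = trans (sym (fromℚᵘ-homo-* (mkℚᵘ (+ suc ℓ') 0) (mkℚᵘ (+ 1) ℓ')))
    (ℚ.fromℚᵘ-cong {mkℚᵘ (+ suc ℓ') 0 ℚᵘ.* mkℚᵘ (+ 1) ℓ'} {mkℚᵘ (+ 1) 0}
      (*≡* (trans (ℤ.*-identityʳ _) (trans (ℤ.*-identityʳ (+ suc ℓ'))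
              (sym (trans (ℤ.*-identityˡ _) (cong +_ (*-identityˡ (suc ℓ')))))))))

  -- pred-pow n = (suc ℓ')ⁿ - 1, so that the denominator is a literal successor as fromℚᵘ needs.
  pred-pow : ℕ → ℕ
  pred-pow zero    = 0
  pred-pow (suc n) = pred-pow n + ℓ' * suc (pred-pow n)

  pow≡suc-pred-pow : ∀ n → suc ℓ' ℕ.^ n ≡ suc (pred-pow n)
  pow≡suc-pred-pow zero    = refl
  pow≡suc-pred-pow (suc n) = cong (suc ℓ' *_) (pow≡suc-pred-pow n)

  /suc-pred-pow : ∀ z n → z / suc (pred-pow n) ≡ [ z ] ℚ.* ℓ⁻¹ ^ n
  /suc-pred-pow z zero    = sym (ℚ.*-identityʳ [ z ])
  /suc-pred-pow z (suc n) = begin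
    z / suc (pred-pow (suc n))
      ≡⟨ ℚ.fromℚᵘ-cong {mkℚᵘ z (pred-pow (suc n))} {mkℚᵘ z (pred-pow n) ℚᵘ.* mkℚᵘ (+ 1) ℓ'}
           (*≡* (trans (cong (λ t → z ℤ.* + t) (*-comm (suc (pred-pow n)) (suc ℓ')))
                       (cong (ℤ._* + (suc ℓ' * suc (pred-pow n))) (sym (ℤ.*-identityʳ z))))) ⟩
    fromℚᵘ (mkℚᵘ z (pred-pow n) ℚᵘ.* mkℚᵘ (+ 1) ℓ')
      ≡⟨ fromℚᵘ-homo-* (mkℚᵘ z (pred-pow n)) (mkℚᵘ (+ 1) ℓ') ⟩
    z / suc (pred-pow n) ℚ.* ℓ⁻¹
      ≡⟨ cong (ℚ._* ℓ⁻¹) (/suc-pred-pow z n) ⟩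
    [ z ] ℚ.* ℓ⁻¹ ^ n ℚ.* ℓ⁻¹
      ≡⟨ solve 3 (λ x p l → x :* p :* l := x :* (l :* p)) refl [ z ] (ℓ⁻¹ ^ n) ℓ⁻¹ ⟩
    [ z ] ℚ.* ℓ⁻¹ ^ suc n ∎
    where
      open ≡-Reasoning
      open ℚSolver

  divPow≡ : ∀ z n → divPow z (suc ℓ') n ≡ [ z ] ℚ.* ℓ⁻¹ ^ n
  divPow≡ z n =
    trans (ℚ./-cong {z} {suc ℓ' ℕ.^ n} {z} {{m^n≢0 (suc ℓ') n}} refl (pow≡suc-pred-pow n)) (/suc-pred-pow z n)

open FiniteSums using (Σ<; δ)

sumFin≡Σ< : ∀ m (g : ℕ → ℚ) → sumFin {m} (g ∘ toℕ) ≡ Σ< m g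
sumFin≡Σ< m g = begin
  foldr ℚ._+_ 0ℚ (map (g ∘ toℕ) (toList (allFin m)))
    ≡⟨ cong (foldr ℚ._+_ 0ℚ ∘ map (g ∘ toℕ)) (toList-tabulate {m = m} (λ i → i)) ⟩
  foldr ℚ._+_ 0ℚ (map (g ∘ toℕ) (List.tabulate {n = m} (λ i → i)))
    ≡⟨ cong (foldr ℚ._+_ 0ℚ) (map-tabulate {n = m} (λ i → i) (g ∘ toℕ)) ⟩
  foldr ℚ._+_ 0ℚ (List.tabulate {n = m} (g ∘ toℕ))
    ≡⟨ foldr-tabulate m g ⟩
  Σ< m g ∎
  where
    open ≡-Reasoning
    foldr-tabulate : ∀ m (g : ℕ → ℚ) → foldr ℚ._+_ 0ℚ (List.tabulate {n = m} (g ∘ toℕ)) ≡ Σ< m g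
    foldr-tabulate zero    g = refl
    foldr-tabulate (suc m) g = cong (g 0 ℚ.+_) (foldr-tabulate m (g ∘ suc))

identity≡δ : ∀ {M} (i j : Fin (suc M)) → identity i j ≡ δ (toℕ i) (toℕ j)
identity≡δ i j with i Fin.≟ j
... | yes refl rewrite ≡ᵇ-refl (toℕ i) = refl
... | no  i≢j with toℕ i ≡ᵇ toℕ j in eq
...   | false = refl
...   | true  = ⊥-elim (i≢j (toℕ-injective (≡ᵇ-true⇒≡ eq)))

⊗≡identity : ∀ {M} (A B : Matrix M) (t u : ℕ → ℕ → ℚ) →
  (∀ i k → A i k ≡ t (toℕ i) (toℕ k)) → (∀ k j → B k j ≡ u (toℕ k) (toℕ j)) →
  (∀ n j → n < suc M → Σ< (suc M) (λ k → t n k ℚ.* u k j) ≡ δ n j) →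
  ∀ i j → (A ⊗ B) i j ≡ identity i j
⊗≡identity {M} A B t u A≡t B≡u t·u≡δ i j = begin
  sumFin (λ k → A i k ℚ.* B k j)
    ≡⟨ cong (foldr ℚ._+_ 0ℚ) (map-cong (λ k → cong₂ ℚ._*_ (A≡t i k) (B≡u k j)) (toList (allFin (suc M)))) ⟩
  sumFin {suc M} (λ k → t (toℕ i) (toℕ k) ℚ.* u (toℕ k) (toℕ j))
    ≡⟨ sumFin≡Σ< (suc M) (λ k → t (toℕ i) k ℚ.* u k (toℕ j)) ⟩
  Σ< (suc M) (λ k → t (toℕ i) k ℚ.* u k (toℕ j))
    ≡⟨ t·u≡δ (toℕ i) (toℕ j) (toℕ<n i) ⟩
  δ (toℕ i) (toℕ j)
    ≡⟨ identity≡δ i j ⟨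
  identity i j ∎
  where open ≡-Reasoning

sign-suc : ∀ m → signℤ (suc m) ≡ ℤ.- signℤ m
sign-suc zero          = refl
sign-suc (suc zero)    = refl
sign-suc (suc (suc m)) = sign-suc m

module Normalisation (a : ℕ) (L : Subset a) (ℓ' : ℕ) (∣L∣≡ : ∣ L ∣ ≡ suc ℓ') where

  open Words a
  open Statistics a L
  open Scaling ℓ'

  b : ℕ → ℚ
  b j = [ + neutral j ] ℚ.* ℓ⁻¹

  open GeneralisedStirling b public

  scaled : ℕ → ℕ → ℚ
  scaled n C = [ + C ] ℚ.* ℓ⁻¹ ^ n

  scaled-step : ∀ n A B M → scaled (suc n) (ℓ * A + M * B) ≡ scaled n A ℚ.+ ([ + M ] ℚ.* ℓ⁻¹) ℚ.* scaled n B
  scaled-step n A B M = begin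
    [ + (ℓ * A + M * B) ] ℚ.* (ℓ⁻¹ ℚ.* X)
      ≡⟨ cong (ℚ._* (ℓ⁻¹ ℚ.* X)) (trans ([+]-homo-+ (ℓ * A) (M * B))
           (cong₂ ℚ._+_ (trans ([+]-homo-* ℓ A) (cong (λ m → [ + m ] ℚ.* [ + A ]) ∣L∣≡)) ([+]-homo-* M B))) ⟩
    ([ + suc ℓ' ] ℚ.* [ + A ] ℚ.+ [ + M ] ℚ.* [ + B ]) ℚ.* (ℓ⁻¹ ℚ.* X)
      ≡⟨ solve 6 (λ l A M B Λ X → (l :* A :+ M :* B) :* (Λ :* X) := (l :* Λ) :* (A :* X) :+ (M :* Λ) :* (B :* X))
           refl [ + suc ℓ' ] [ + A ] [ + M ] [ + B ] ℓ⁻¹ X ⟩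
    (([ + suc ℓ' ] ℚ.* ℓ⁻¹) ℚ.* ([ + A ] ℚ.* X)) ℚ.+ ([ + M ] ℚ.* ℓ⁻¹) ℚ.* ([ + B ] ℚ.* X)
      ≡⟨ cong (λ t → t ℚ.* ([ + A ] ℚ.* X) ℚ.+ ([ + M ] ℚ.* ℓ⁻¹) ℚ.* ([ + B ] ℚ.* X)) ℓ*ℓ⁻¹ ⟩
    1ℚ ℚ.* ([ + A ] ℚ.* X) ℚ.+ ([ + M ] ℚ.* ℓ⁻¹) ℚ.* ([ + B ] ℚ.* X)
      ≡⟨ cong (ℚ._+ ([ + M ] ℚ.* ℓ⁻¹) ℚ.* ([ + B ] ℚ.* X)) (ℚ.*-identityˡ ([ + A ] ℚ.* X)) ⟩
    scaled n A ℚ.+ ([ + M ] ℚ.* ℓ⁻¹) ℚ.* scaled n B ∎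
    where
      open ≡-Reasoning
      open ℚSolver
      X = ℓ⁻¹ ^ n

  scaled-mult : ∀ n A M → scaled (suc n) (M * A) ≡ ([ + M ] ℚ.* ℓ⁻¹) ℚ.* scaled n A
  scaled-mult n A M = trans (cong (ℚ._* (ℓ⁻¹ ℚ.* ℓ⁻¹ ^ n)) ([+]-homo-* M A))
    (solve 4 (λ M A Λ X → M :* A :* (Λ :* X) := (M :* Λ) :* (A :* X)) refl [ + M ] [ + A ] ℓ⁻¹ (ℓ⁻¹ ^ n))
    where open ℚSolver

  s S : ℕ → ℕ → ℚ
  s n k = [ signℤ (n + k) ] ℚ.* scaled n (minCount n k)
  S n k = scaled n (desMinCount n k)

  s≡stirling₁ : ∀ n k → s n k ≡ stirling₁ n k
  s≡stirling₁ zero    zero    = refl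
  s≡stirling₁ zero    (suc k) = ℚ.*-zeroʳ [ signℤ (suc k) ]
  s≡stirling₁ (suc n) zero    = begin
    [ σ′ ] ℚ.* scaled (suc n) (minCount (suc n) 0)
      ≡⟨ cong₂ (λ x y → [ x ] ℚ.* y) (sign-suc (n + 0))
               (trans (cong (scaled (suc n)) (minCount-suc-zero n)) (scaled-mult n (minCount n 0) (neutral n))) ⟩
    [ ℤ.- σ ] ℚ.* (b n ℚ.* scaled n (minCount n 0))
      ≡⟨ cong (ℚ._* (b n ℚ.* scaled n (minCount n 0))) ([]-homo‿- σ) ⟩
    ℚ.- [ σ ] ℚ.* (b n ℚ.* scaled n (minCount n 0))
      ≡⟨ solve 3 (λ x y z → (:- x) :* (y :* z) := :- (y :* (x :* z))) refl [ σ ] (b n) (scaled n (minCount n 0)) ⟩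
    ℚ.- (b n ℚ.* s n 0)
      ≡⟨ cong (λ x → ℚ.- (b n ℚ.* x)) (s≡stirling₁ n 0) ⟩
    stirling₁ (suc n) 0 ∎
    where
      open ≡-Reasoning
      open ℚSolver
      σ′ = signℤ (suc n + 0)
      σ  = signℤ (n + 0)
  s≡stirling₁ (suc n) (suc k) = begin
    [ signℤ (suc n + suc k) ] ℚ.* scaled (suc n) (minCount (suc n) (suc k))
      ≡⟨ cong₂ (λ x y → [ x ] ℚ.* y) (cong (signℤ ∘ suc) (+-suc n k))
               (trans (cong (scaled (suc n)) (minCount-suc-suc n k))
                      (scaled-step n (minCount n k) (minCount n (suc k)) (neutral n))) ⟩
    [ σ ] ℚ.* (scaled n (minCount n k) ℚ.+ b n ℚ.* scaled n (minCount n (suc k)))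
      ≡⟨ solve 4 (λ x A B y → x :* (A :+ y :* B) := x :* A :- y :* ((:- x) :* B)) refl
           [ σ ] (scaled n (minCount n k)) (scaled n (minCount n (suc k))) (b n) ⟩
    [ σ ] ℚ.* scaled n (minCount n k) ℚ.- b n ℚ.* ((ℚ.- [ σ ]) ℚ.* scaled n (minCount n (suc k)))
      ≡⟨ cong (λ x → s n k ℚ.- b n ℚ.* (x ℚ.* scaled n (minCount n (suc k))))
           (trans (sym ([]-homo‿- σ)) (cong [_] (trans (sym (sign-suc (n + k))) (cong signℤ (sym (+-suc n k)))))) ⟩
    s n k ℚ.- b n ℚ.* s n (suc k)
      ≡⟨ cong₂ (λ x y → x ℚ.- b n ℚ.* y) (s≡stirling₁ n k) (s≡stirling₁ n (suc k)) ⟩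
    stirling₁ (suc n) (suc k) ∎
    where
      open ≡-Reasoning
      open ℚSolver
      σ = signℤ (n + k)

  S≡stirling₂ : ∀ n k → S n k ≡ stirling₂ n k
  S≡stirling₂ zero    zero    = refl
  S≡stirling₂ zero    (suc k) = refl
  S≡stirling₂ (suc n) zero    =
    trans (cong (scaled (suc n)) (desMinCount-suc-zero n))
      (trans (scaled-mult n (desMinCount n 0) (neutral 0)) (cong (b 0 ℚ.*_) (S≡stirling₂ n 0)))
  S≡stirling₂ (suc n) (suc k) =
    trans (cong (scaled (suc n)) (desMinCount-suc-suc n k))
      (trans (scaled-step n (desMinCount n k) (desMinCount n (suc k)) (neutral (suc k)))
             (cong₂ (λ x y → x ℚ.+ b (suc k) ℚ.* y) (S≡stirling₂ n k) (S≡stirling₂ n (suc k))))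

  cntMin≡minCount : ∀ n k → cntMin a L n k ≡ minCount n k
  cntMin≡minCount n k =
    trans (sym (count-map (minIs k) letters (wreath a n))) (count-↭ (minIs k) (wreath↭words n))

  cntDesMin≡desMinCount : ∀ n k → cntDesMin a L n k ≡ desMinCount n k
  cntDesMin≡desMinCount n k =
    trans (sym (count-map (desMinIs k) letters (wreath a n))) (count-↭ (desMinIs k) (wreath↭words n))

  divPow-∣L∣ : ∀ z n → divPow z ∣ L ∣ n ≡ [ z ] ℚ.* ℓ⁻¹ ^ n
  divPow-∣L∣ z n = trans (cong (λ m → divPow z m n) ∣L∣≡) (divPow≡ z n)

  sMat≡stirling₁ : ∀ M (i k : Fin (suc M)) → sMat a L M i k ≡ stirling₁ (toℕ i) (toℕ k)
  sMat≡stirling₁ M i k = begin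
    divPow (σ ℤ.* + cntMin a L n m) (∣ L ∣) n
      ≡⟨ cong (λ c → divPow (σ ℤ.* + c) (∣ L ∣) n) (cntMin≡minCount n m) ⟩
    divPow (σ ℤ.* + minCount n m) (∣ L ∣) n
      ≡⟨ divPow-∣L∣ (σ ℤ.* + minCount n m) n ⟩
    [ σ ℤ.* + minCount n m ] ℚ.* ℓ⁻¹ ^ n
      ≡⟨ cong (ℚ._* ℓ⁻¹ ^ n) ([]-homo-* σ (+ minCount n m)) ⟩
    [ σ ] ℚ.* [ + minCount n m ] ℚ.* ℓ⁻¹ ^ n
      ≡⟨ ℚ.*-assoc [ σ ] _ _ ⟩
    s n m
      ≡⟨ s≡stirling₁ n m ⟩
    stirling₁ n m ∎
    where
      open ≡-Reasoning
      n = toℕ i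
      m = toℕ k
      σ = signℤ (n + m)

  SMat≡stirling₂ : ∀ M (i k : Fin (suc M)) → SMat a L M i k ≡ stirling₂ (toℕ i) (toℕ k)
  SMat≡stirling₂ M i k =
    trans (cong (λ c → divPow (+ c) ∣ L ∣ (toℕ i)) (cntDesMin≡desMinCount (toℕ i) (toℕ k)))
          (trans (divPow-∣L∣ _ (toℕ i)) (S≡stirling₂ (toℕ i) (toℕ k)))

nonempty⇒∣p∣≡suc : ∀ {m} (p : Subset m) → Nonempty p → ∃ λ ℓ' → ∣ p ∣ ≡ suc ℓ'
nonempty⇒∣p∣≡suc (true  ∷ᵥ p) _                     = ∣ p ∣ , refl
nonempty⇒∣p∣≡suc (false ∷ᵥ p) (Fin.suc f , there f∈p) = nonempty⇒∣p∣≡suc p (f , f∈p)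

-- a ≥ 1 already follows from L being nonempty, and the identity holds for N = 0 as well.
theorem1p2 : (a N : ℕ) → 1 ≤ a → 1 ≤ N → (L : Subset a) → Nonempty L →
    ((i j : Fin (suc N)) → (SMat a L N ⊗ sMat a L N) i j ≡ identity i j) ×
    ((i j : Fin (suc N)) → (sMat a L N ⊗ SMat a L N) i j ≡ identity i j)
theorem1p2 a N _ _ L L≢∅ with ℓ' , ∣L∣≡ ← nonempty⇒∣p∣≡suc L L≢∅ =
  let open Normalisation a L ℓ' ∣L∣≡ in
    ⊗≡identity (SMat a L N) (sMat a L N) stirling₂ stirling₁ (SMat≡stirling₂ N) (sMat≡stirling₁ N)
      (λ n j → stirling₂-stirling₁-inverse n j (suc N))
  , ⊗≡identity (sMat a L N) (SMat a L N) stirling₁ stirling₂ (sMat≡stirling₁ N) (SMat≡stirling₂ N)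
      (λ n j → stirling₁-stirling₂-inverse n j (suc N))
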